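{- Let $f$ and $g$ be distinct elements of a matroid $M$ such that $f$ is freer than $g$ in $M$. Let $L$ be the matroid obtained from $M$ by deleting every element of $E(M)-\{f,g\}$ that is parallel to $g$. Then $h(f;M)=h(g;M)$ if and only if $f$ and $g$ are clones in $L$.
   Context: For distinct elements $f,g$ of a matroid $M$, $f$ is freer than $g$ if $g$ is contained in the closure of every circuit of $M$ that contains $f$. $h(e;M)$ is the number of hyperplanes of $M$ containing $e$. Elements $x,y$ of a matroid $L$ are clones if the bijection $E(L)\to E(L)$ that interchanges $x$ and $y$ and fixes every other element is an automorphism of $L$. -}

module Defs where

open import Data.Nat using (ℕ; zero; suc; _<_; _⊔_; _≡ᵇ_)
open import Data.Bool using (Bool; true; false; _∧_; _∨_)
open import Data.Fin using (Fin; _≟_)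
open import Data.Fin.Subset using (Subset; _∈_; _∉_; _⊆_; _∪_; ⁅_⁆; ∣_∣; ⊥; ⊤)
open import Data.Fin.Subset.Properties using (_∈?_; _⊆?_)
open import Data.Fin.Permutation using (Permutation′; _⟨$⟩ˡ_; _⟨$⟩ʳ_; transpose)
open import Data.Vec using (Vec; []; _∷_; tabulate; lookup)
open import Data.Vec.Properties using (≡-dec)
open import Data.List using (List; []; _∷_; _++_; map; filter; foldr; length)
open import Data.Product using (Σ; ∃; _×_; _,_)
open import Relation.Nullary using (¬_; Dec; does; yes; no)
open import Relation.Nullary.Decidable using (_×-dec_)
open import Relation.Binary.PropositionalEquality using (_≡_; _≢_)
open import Function.Bundles using (_⇔_)
import Data.Bool.Properties as BoolP
import Data.Nat.Properties as NatP

record Matroid (n : ℕ) : Set₁ where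
  field
    E        : Subset n
    Indep    : Subset n → Set
    indep?   : (I : Subset n) → Dec (Indep I)
    indep⊆E  : ∀ {I} → Indep I → I ⊆ E
    indep-∅  : Indep ⊥
    indep-⊆  : ∀ {I J} → Indep J → I ⊆ J → Indep I
    augment  : ∀ {I J} → Indep I → Indep J → ∣ I ∣ < ∣ J ∣ →
               ∃ λ e → e ∈ J × e ∉ I × Indep (I ∪ ⁅ e ⁆)

open Matroid public

allSubsets : (n : ℕ) → List (Subset n)
allSubsets zero    = [] ∷ []
allSubsets (suc n) = map (false ∷_) (allSubsets n) ++ map (true ∷_) (allSubsets n)

maxℕ : List ℕ → ℕ
maxℕ = foldr _⊔_ 0

module _ {n : ℕ} (M : Matroid n) where

  rank : Subset n → ℕ
  rank X = maxℕ (map ∣_∣ (filter (λ I → (I ⊆? X) ×-dec indep? M I) (allSubsets n)))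

  closure : Subset n → Subset n
  closure X = tabulate (λ e → does (e ∈? E M) ∧ (rank (X ∪ ⁅ e ⁆) ≡ᵇ rank X))

  IsFlat : Subset n → Set
  IsFlat X = closure X ≡ X

  IsHyperplane : Subset n → Set
  IsHyperplane H = IsFlat H × suc (rank H) ≡ rank (E M)

  isHyperplane? : (H : Subset n) → Dec (IsHyperplane H)
  isHyperplane? H = ≡-dec BoolP._≟_ (closure H) H ×-dec (suc (rank H) NatP.≟ rank (E M))

  h : Fin n → ℕ
  h e = length (filter (λ H → (e ∈? H) ×-dec isHyperplane? H) (allSubsets n))

  IsCircuit : Subset n → Set
  IsCircuit C = C ⊆ E M × ¬ Indep M C × (∀ D → D ⊆ C → D ≢ C → Indep M D)

  Freer : Fin n → Fin n → Set
  Freer f g = ∀ C → IsCircuit C → f ∈ C → g ∈ closure C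

  Parallel : Fin n → Fin n → Set
  Parallel e g = e ≢ g × IsCircuit (⁅ e ⁆ ∪ ⁅ g ⁆)

IsDeletion : {n : ℕ} → Matroid n → Matroid n → (Fin n → Set) → Set
IsDeletion {n} L M D =
  (∀ x → (x ∈ E L) ⇔ (x ∈ E M × ¬ D x)) ×
  (∀ I → Indep L I ⇔ (I ⊆ E L × Indep M I))

image : {n : ℕ} → Permutation′ n → Subset n → Subset n
image σ I = tabulate (λ y → lookup I (σ ⟨$⟩ˡ y))

IsAutomorphism : {n : ℕ} → Matroid n → Permutation′ n → Set
IsAutomorphism L σ =
  (∀ x → (x ∈ E L) ⇔ ((σ ⟨$⟩ʳ x) ∈ E L)) ×
  (∀ I → I ⊆ E L → (Indep L I ⇔ Indep L (image σ I)))

Clones : {n : ℕ} → Matroid n → Fin n → Fin n → Set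
Clones L x y = IsAutomorphism L (transpose x y)

{-# OPTIONS --safe #-}
-- Call a hyperplane e|e′-separating if it contains e but not e′. Hyperplanes through both f and g
-- count towards both h(f) and h(g), so h(f) = h(g) iff there are as many f|g- as g|f-separating
-- hyperplanes. As f is freer than g, H ↦ cl((H - f) ∪ g) maps the f|g-separating hyperplanes onto
-- the g|f-separating ones when g is not a loop, so the counts agree iff this map is injective.
-- It is not injective iff some X avoiding f, g and the elements parallel to g has X ∪ f independent
-- but X ∪ g dependent: a minimal Z ⊆ X with g ∈ cl(Z) then has two elements x₁ ≠ x₂, and for a
-- basis Y ∪ f ⊇ X ∪ f the hyperplanes cl((Y - xᵢ) ∪ f) are distinct with common image cl(Y).
-- Without such X, H - f is recovered from the image of H by removing the elements whose closure
-- contains g. Finally, the absence of such X says that swapping f and g preserves independence in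
-- L, i.e. that f and g are clones in L. If g is a loop, no hyperplane is f|g-separating, and some
-- hyperplane is g|f-separating unless f is a loop as well.
module Submission where

open import Defs
open import Data.Bool using (Bool; true; false; T)
import Data.Bool.Properties as Bool
open import Data.Bool.Properties using (T-≡; T-∧)
open import Data.Empty using (⊥-elim)
open import Data.Fin using (Fin; zero; suc; _≟_)
open import Data.Fin.Permutation using (Permutation′; transpose; _⟨$⟩ˡ_)
import Data.Fin.Permutation.Components as PC
open import Data.Fin.Properties using (any?)
open import Data.Fin.Subset
  using (Subset; _∈_; _∉_; _⊆_; _⊂_; _⊃_; _∪_; _∩_; _─_; _-_; ∁; ⁅_⁆; ∣_∣; ⊥)
open import Data.Fin.Subset.Induction using (⊂-wellFounded; ⊃-wellFounded)
open import Data.Fin.Subset.Properties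
  using (_∈?_; _⊆?_; ⊆-refl; ⊆-reflexive; ⊆-antisym; ⊥⊆; ∉⊥; ∣⊥∣≡0; ∣⁅x⁆∣≡1; p⊆q⇒∣p∣≤∣q∣
        ; x∈⁅x⁆; x∈⁅y⁆⇒x≡y; x∉⁅y⁆⇒x≢y; x∈p∪q⁻; x∈p∪q⁺; p⊆p∪q; q⊆p∪q; x∈p∩q⁺; x∈p∩q⁻
        ; p∩q⊆p; p∩q⊆q; p─q⊆p; x∈p∧x≢y⇒x∈p-y; x∈p⇒p-x⊂p; x∉p⇒x∈∁p; x∈∁p⇒x∉p
        ; ∪-assoc; ∪-comm; ∪-identityˡ; ∪-identityʳ)
open import Data.List using (List; []; _∷_; map; filter; length)
open import Data.List.Membership.Propositional using () renaming (_∈_ to _∈ₗ_; _─_ to _─ₗ_)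
open import Data.List.Membership.Propositional.Properties
  using (∈-map⁺; ∈-map⁻; ∈-++⁺ˡ; ∈-++⁺ʳ; ∈-filter⁺; ∈-filter⁻)
open import Data.List.Properties
  using (length-map; length-removeAt′; filter-≐; filter-none; filter-some)
open import Data.List.Relation.Binary.Subset.Propositional using () renaming (_⊆_ to _⊆ₗ_)
import Data.List.Relation.Unary.All as All
open import Data.List.Relation.Unary.AllPairs using ([]; _∷_)
import Data.List.Relation.Unary.Any as Any
open import Data.List.Relation.Unary.Any using (here; there; index)
open import Data.List.Relation.Unary.Unique.Propositional using (Unique)
import Data.List.Relation.Unary.Unique.Propositional.Properties as Unique
open import Data.Nat using (ℕ; zero; suc; _+_; _≤_; _<_; _≤?_; z≤n; s≤s)
open import Data.Nat.Properties
  using (≤-trans; ≤-antisym; ≤-reflexive; <-irrefl; ≰⇒>; n<1+n; 1+n≢n; 1+n≰n; m≤m+n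
        ; m≤m⊔n; m≤n⊔m; ⊔-sel; +-suc; +-comm; +-mono-≤; +-monoʳ-≤; +-cancelʳ-≤; +-cancelˡ-≡
        ; ≡ᵇ⇒≡; ≡⇒≡ᵇ; module ≤-Reasoning)
open import Data.Product using (∃; ∃₂; _×_; _,_; proj₁; proj₂)
import Data.Sum as Sum
open import Data.Sum using (_⊎_; inj₁; inj₂; [_,_]′)
open import Data.Vec using ([]; _∷_; tabulate; here; there)
open import Data.Vec.Properties
  using (lookup∘tabulate; []=⇒lookup; lookup⇒[]=; ≡-dec; ∷-injectiveˡ; ∷-injectiveʳ)
open import Function using (id; _∘_; case_of_)
open import Function.Bundles using (_⇔_; mk⇔; Equivalence)
open import Function.Construct.Composition using () renaming (equivalence to ⇔-trans)
open import Function.Construct.Identity using (⇔-id)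
open import Function.Construct.Symmetry using (⇔-sym)
open import Induction.WellFounded using (Acc; acc)
open import Level using (0ℓ)
open import Relation.Binary.PropositionalEquality
  using (_≡_; _≢_; refl; sym; trans; cong; cong₂; subst; module ≡-Reasoning)
open import Relation.Nullary using (¬_; Dec; yes; no; does; contradiction)
open import Relation.Nullary.Decidable using (_×-dec_; ¬?; decidable-stable)
open import Relation.Unary using (Pred; Decidable; _≐_)
open import Relation.Unary.Properties using (_∩?_; ∁?)

open Equivalence using (to; from)

private variable
  n : ℕ
  p q I J K X Y Z H : Subset n
  e x y : Fin n

-- Subsets of Fin n

∪-least : ∀ {p q s : Subset n} → p ⊆ s → q ⊆ s → p ∪ q ⊆ s
∪-least {p = p} {q} p⊆s q⊆s x∈p∪q = [ p⊆s , q⊆s ]′ (x∈p∪q⁻ p q x∈p∪q)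

⁅x⁆⊆p : ∀ {p : Subset n} {x} → x ∈ p → ⁅ x ⁆ ⊆ p
⁅x⁆⊆p {x = x} x∈p y∈⁅x⁆ rewrite x∈⁅y⁆⇒x≡y x y∈⁅x⁆ = x∈p

x∈p∪⁅y⁆⁻ : ∀ {p : Subset n} {x y} → x ∈ p ∪ ⁅ y ⁆ → x ∈ p ⊎ x ≡ y
x∈p∪⁅y⁆⁻ {p = p} {y = y} = Sum.map₂ (x∈⁅y⁆⇒x≡y y) ∘ x∈p∪q⁻ p ⁅ y ⁆

y∈p∪⁅y⁆ : ∀ {p : Subset n} {y} → y ∈ p ∪ ⁅ y ⁆
y∈p∪⁅y⁆ {p = p} {y} = q⊆p∪q p ⁅ y ⁆ (x∈⁅x⁆ y)

x∈p─q⇒x∉q : ∀ (p q : Subset n) → x ∈ p ─ q → x ∉ q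
x∈p─q⇒x∉q (true  ∷ p) (true ∷ q) () here
x∈p─q⇒x∉q (false ∷ p) (true ∷ q) () here
x∈p─q⇒x∉q (_ ∷ p) (_ ∷ q) (there x∈p─q) (there x∈q) = x∈p─q⇒x∉q p q x∈p─q x∈q

x∈p-y⁻ : ∀ {p : Subset n} {x y} → x ∈ p - y → x ∈ p × x ≢ y
x∈p-y⁻ {p = p} {y = y} x∈p-y =
  p─q⊆p p ⁅ y ⁆ x∈p-y , x∉⁅y⁆⇒x≢y (x∈p─q⇒x∉q p ⁅ y ⁆ x∈p-y)

p∪⁅x⁆≡p : ∀ {p : Subset n} {x} → x ∈ p → p ∪ ⁅ x ⁆ ≡ p
p∪⁅x⁆≡p x∈p = ⊆-antisym (∪-least id (⁅x⁆⊆p x∈p)) (p⊆p∪q _)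

⊆p∪⁅y⁆⇒⊆p : q ⊆ p ∪ ⁅ y ⁆ → y ∉ q → q ⊆ p
⊆p∪⁅y⁆⇒⊆p q⊆p∪y y∉q x∈q with x∈p∪⁅y⁆⁻ (q⊆p∪y x∈q)
... | inj₁ x∈p  = x∈p
... | inj₂ refl = contradiction x∈q y∉q

y∉p-y : y ∉ p - y
y∉p-y y∈p-y = proj₂ (x∈p-y⁻ y∈p-y) refl

p-y⊆p : p - y ⊆ p
p-y⊆p = proj₁ ∘ x∈p-y⁻

p-y∪⁅y⁆≡p : ∀ {p : Subset n} {y} → y ∈ p → (p - y) ∪ ⁅ y ⁆ ≡ p
p-y∪⁅y⁆≡p {p = p} {y} y∈p = ⊆-antisym (∪-least p-y⊆p (⁅x⁆⊆p y∈p)) p⊆p-y∪⁅y⁆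
  where
  p⊆p-y∪⁅y⁆ : p ⊆ (p - y) ∪ ⁅ y ⁆
  p⊆p-y∪⁅y⁆ {x} x∈p with x ≟ y
  ... | yes refl = y∈p∪⁅y⁆
  ... | no x≢y   = p⊆p∪q _ (x∈p∧x≢y⇒x∈p-y x∈p x≢y)

∪⁅⁆-swap : ∀ (p : Subset n) x y → (p ∪ ⁅ x ⁆) ∪ ⁅ y ⁆ ≡ (p ∪ ⁅ y ⁆) ∪ ⁅ x ⁆
∪⁅⁆-swap p x y = begin
  (p ∪ ⁅ x ⁆) ∪ ⁅ y ⁆ ≡⟨ ∪-assoc p ⁅ x ⁆ ⁅ y ⁆ ⟩
  p ∪ (⁅ x ⁆ ∪ ⁅ y ⁆) ≡⟨ cong (p ∪_) (∪-comm ⁅ x ⁆ ⁅ y ⁆) ⟩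
  p ∪ (⁅ y ⁆ ∪ ⁅ x ⁆) ≡⟨ ∪-assoc p ⁅ y ⁆ ⁅ x ⁆ ⟨
  (p ∪ ⁅ y ⁆) ∪ ⁅ x ⁆ ∎
  where open ≡-Reasoning

∣p∪⁅x⁆∣≡1+∣p∣ : ∀ (p : Subset n) x → x ∉ p → ∣ p ∪ ⁅ x ⁆ ∣ ≡ suc ∣ p ∣
∣p∪⁅x⁆∣≡1+∣p∣ (false ∷ p) zero    _   = cong (suc ∘ ∣_∣) (∪-identityʳ p)
∣p∪⁅x⁆∣≡1+∣p∣ (true  ∷ p) zero    x∉p = contradiction here x∉p
∣p∪⁅x⁆∣≡1+∣p∣ (false ∷ p) (suc x) x∉p = ∣p∪⁅x⁆∣≡1+∣p∣ p x (x∉p ∘ there)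
∣p∪⁅x⁆∣≡1+∣p∣ (true  ∷ p) (suc x) x∉p = cong suc (∣p∪⁅x⁆∣≡1+∣p∣ p x (x∉p ∘ there))

∣p∣+∣q∣≡∣p∪q∣+∣p∩q∣ : ∀ (p q : Subset n) → ∣ p ∣ + ∣ q ∣ ≡ ∣ p ∪ q ∣ + ∣ p ∩ q ∣
∣p∣+∣q∣≡∣p∪q∣+∣p∩q∣ []          []          = refl
∣p∣+∣q∣≡∣p∪q∣+∣p∩q∣ (true  ∷ p) (true  ∷ q) = cong suc (begin
  ∣ p ∣ + suc ∣ q ∣              ≡⟨ +-suc ∣ p ∣ ∣ q ∣ ⟩
  suc (∣ p ∣ + ∣ q ∣)            ≡⟨ cong suc (∣p∣+∣q∣≡∣p∪q∣+∣p∩q∣ p q) ⟩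
  suc (∣ p ∪ q ∣ + ∣ p ∩ q ∣)    ≡⟨ +-suc ∣ p ∪ q ∣ ∣ p ∩ q ∣ ⟨
  ∣ p ∪ q ∣ + suc ∣ p ∩ q ∣      ∎)
  where open ≡-Reasoning
∣p∣+∣q∣≡∣p∪q∣+∣p∩q∣ (true  ∷ p) (false ∷ q) = cong suc (∣p∣+∣q∣≡∣p∪q∣+∣p∩q∣ p q)
∣p∣+∣q∣≡∣p∪q∣+∣p∩q∣ (false ∷ p) (true  ∷ q) =
  trans (+-suc ∣ p ∣ ∣ q ∣) (cong suc (∣p∣+∣q∣≡∣p∪q∣+∣p∩q∣ p q))
∣p∣+∣q∣≡∣p∪q∣+∣p∩q∣ (false ∷ p) (false ∷ q) = ∣p∣+∣q∣≡∣p∪q∣+∣p∩q∣ p q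

T-does⇔ : ∀ {P : Set} (P? : Dec P) → T (does P?) ⇔ P
T-does⇔ (yes p)  = mk⇔ (λ _ → p) (λ _ → _)
T-does⇔ (no  ¬p) = mk⇔ (λ ()) ¬p

x∈tabulate⇔ : ∀ {x} {f : Fin n → Bool} → x ∈ tabulate f ⇔ T (f x)
x∈tabulate⇔ {x = x} {f} = mk⇔
  (λ x∈ → from T-≡ (trans (sym (lookup∘tabulate f x)) ([]=⇒lookup x∈)))
  (λ Tfx → lookup⇒[]= x (tabulate f) (trans (lookup∘tabulate f x) (to T-≡ Tfx)))

∃-∉ : ∀ {p q : Subset n} → p ⊆ q → p ≢ q → ∃ λ x → x ∈ q × x ∉ p
∃-∉ {p = p} {q} p⊆q p≢q with any? (λ x → x ∈? q ×-dec ¬? (x ∈? p))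
... | yes witness = witness
... | no ∄ = contradiction (⊆-antisym p⊆q q⊆p) p≢q
  where
  q⊆p : q ⊆ p
  q⊆p {x} x∈q = decidable-stable (x ∈? p) (λ x∉p → ∄ (x , x∈q , x∉p))

∃-minimal : {Q : Pred (Subset n) 0ℓ} → Decidable Q → Q p →
            ∃ λ m → m ⊆ p × Q m × (∀ {x} → x ∈ m → ¬ Q (m - x))
∃-minimal {Q = Q} Q? = go (⊂-wellFounded _)
  where
  go : Acc _⊂_ p → Q p → ∃ λ m → m ⊆ p × Q m × (∀ {x} → x ∈ m → ¬ Q (m - x))
  go {p} (acc smaller) Qp with any? (λ x → x ∈? p ×-dec Q? (p - x))
  ... | no ∄ = p , id , Qp , λ x∈p Qp-x → ∄ (_ , x∈p , Qp-x)
  ... | yes (x , x∈p , Qp-x) with go (smaller (x∈p⇒p-x⊂p x∈p)) Qp-x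
  ...   | m , m⊆p-x , Qm , minimal = m , p-y⊆p ∘ m⊆p-x , Qm , minimal

-- Counting subsets

module _ {A : Set} where

  ∈-─⁺ : ∀ {x y : A} {xs} (y∈xs : y ∈ₗ xs) → x ∈ₗ xs → x ≢ y → x ∈ₗ xs ─ₗ y∈xs
  ∈-─⁺ (here refl)  (here refl)  x≢y = contradiction refl x≢y
  ∈-─⁺ (here refl)  (there x∈xs) _   = x∈xs
  ∈-─⁺ (there y∈xs) (here refl)  _   = here refl
  ∈-─⁺ (there y∈xs) (there x∈xs) x≢y = there (∈-─⁺ y∈xs x∈xs x≢y)

  length-≤-⊆ : ∀ {xs ys : List A} → Unique xs → xs ⊆ₗ ys → length xs ≤ length ys
  length-≤-⊆ [] _ = z≤n
  length-≤-⊆ {x ∷ xs} {ys} (x∉xs ∷ unique) xs⊆ys = begin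
    suc (length xs)           ≤⟨ s≤s (length-≤-⊆ unique xs⊆ys─x) ⟩
    suc (length (ys ─ₗ x∈ys)) ≡⟨ length-removeAt′ ys (index x∈ys) ⟨
    length ys                 ∎
    where
    open ≤-Reasoning
    x∈ys : x ∈ₗ ys
    x∈ys = xs⊆ys (here refl)
    xs⊆ys─x : xs ⊆ₗ ys ─ₗ x∈ys
    xs⊆ys─x z∈xs = ∈-─⁺ x∈ys (xs⊆ys (there z∈xs)) (λ z≡x → All.lookup x∉xs z∈xs (sym z≡x))

  length-filter-split : ∀ {P Q : Pred A 0ℓ} (P? : Decidable P) (Q? : Decidable Q) xs →
    length (filter P? xs) ≡ length (filter (P? ∩? Q?) xs) + length (filter (P? ∩? ∁? Q?) xs)
  length-filter-split P? Q? [] = refl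
  length-filter-split P? Q? (x ∷ xs) with P? x | Q? x
  ... | yes _ | yes _ = cong suc (length-filter-split P? Q? xs)
  ... | yes _ | no  _ = trans (cong suc (length-filter-split P? Q? xs)) (sym (+-suc _ _))
  ... | no  _ | _     = length-filter-split P? Q? xs

∈-allSubsets : ∀ (p : Subset n) → p ∈ₗ allSubsets n
∈-allSubsets []                  = here refl
∈-allSubsets {suc n} (false ∷ p) = ∈-++⁺ˡ (∈-map⁺ (false ∷_) (∈-allSubsets p))
∈-allSubsets {suc n} (true  ∷ p) =
  ∈-++⁺ʳ (map (false ∷_) (allSubsets n)) (∈-map⁺ (true ∷_) (∈-allSubsets p))

allSubsets-unique : ∀ n → Unique (allSubsets n)
allSubsets-unique zero    = All.[] ∷ []
allSubsets-unique (suc n) = Unique.++⁺ (Unique.map⁺ ∷-injectiveʳ (allSubsets-unique n))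
                                       (Unique.map⁺ ∷-injectiveʳ (allSubsets-unique n))
                                       disjoint
  where
  disjoint : ∀ {v} → ¬ (v ∈ₗ map (false ∷_) (allSubsets n) × v ∈ₗ map (true ∷_) (allSubsets n))
  disjoint (v∈₁ , v∈₂) with ∈-map⁻ (false ∷_) v∈₁ | ∈-map⁻ (true ∷_) v∈₂
  ... | _ , _ , refl | _ , _ , v≡true∷ with ∷-injectiveˡ v≡true∷
  ... | ()

count : {P : Pred (Subset n) 0ℓ} → Decidable P → ℕ
count {n} P? = length (filter P? (allSubsets n))

module _ {P : Pred (Subset n) 0ℓ} (P? : Decidable P) where

  count≡0 : (∀ p → ¬ P p) → count P? ≡ 0
  count≡0 ∄ = cong length (filter-none P? {xs = allSubsets n} (All.tabulate λ {p} _ → ∄ p))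

  0<count : P p → 0 < count P?
  0<count {p} Pp = filter-some P? {xs = allSubsets n} (Any.map (λ { refl → Pp }) (∈-allSubsets p))

module _ {P Q : Pred (Subset n) 0ℓ} (P? : Decidable P) (Q? : Decidable Q) where

  private
    Ps : List (Subset n)
    Ps = filter P? (allSubsets n)

  count-split : count P? ≡ count (P? ∩? Q?) + count (P? ∩? ∁? Q?)
  count-split = length-filter-split P? Q? (allSubsets n)

  count-≐ : P ≐ Q → count P? ≡ count Q?
  count-≐ P≐Q = cong length (filter-≐ P? Q? P≐Q (allSubsets n))

  count-≤-onto : (φ : Subset n → Subset n) → (∀ {q} → Q q → ∃ λ p → P p × φ p ≡ q) →
                 count Q? ≤ count P?
  count-≤-onto φ onto = begin
    count Q?          ≤⟨ length-≤-⊆ (Unique.filter⁺ Q? (allSubsets-unique n)) Qs⊆φ[Ps] ⟩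
    length (map φ Ps) ≡⟨ length-map φ Ps ⟩
    count P?          ∎
    where
    open ≤-Reasoning
    Qs⊆φ[Ps] : filter Q? (allSubsets n) ⊆ₗ map φ Ps
    Qs⊆φ[Ps] q∈Qs with onto (proj₂ (∈-filter⁻ Q? {xs = allSubsets n} q∈Qs))
    ... | p , Pp , refl = ∈-map⁺ φ (∈-filter⁺ P? (∈-allSubsets p) Pp)

  count-<-onto : (φ : Subset n → Subset n) → (∀ {q} → Q q → ∃ λ p → P p × φ p ≡ q) →
                 ∀ {p₁ p₂} → P p₁ → P p₂ → p₁ ≢ p₂ → φ p₁ ≡ φ p₂ → count Q? < count P?
  count-<-onto φ onto {p₁} {p₂} Pp₁ Pp₂ p₁≢p₂ φp₁≡φp₂ = begin-strict
    count Q?                 ≤⟨ length-≤-⊆ (Unique.filter⁺ Q? (allSubsets-unique n)) Qs⊆φ[Ps─p₂] ⟩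
    length (map φ Ps─p₂)     ≡⟨ length-map φ Ps─p₂ ⟩
    length Ps─p₂             <⟨ n<1+n _ ⟩
    suc (length Ps─p₂)       ≡⟨ length-removeAt′ Ps (index p₂∈Ps) ⟨
    count P?                 ∎
    where
    open ≤-Reasoning
    ∈Ps : ∀ {p} → P p → p ∈ₗ Ps
    ∈Ps {p} = ∈-filter⁺ P? (∈-allSubsets p)
    p₂∈Ps : p₂ ∈ₗ Ps
    p₂∈Ps = ∈Ps Pp₂
    Ps─p₂ : List (Subset n)
    Ps─p₂ = Ps ─ₗ p₂∈Ps
    Qs⊆φ[Ps─p₂] : filter Q? (allSubsets n) ⊆ₗ map φ Ps─p₂
    Qs⊆φ[Ps─p₂] q∈Qs with onto (proj₂ (∈-filter⁻ Q? {xs = allSubsets n} q∈Qs))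
    ... | p , Pp , refl with ≡-dec Bool._≟_ p p₂
    ...   | no p≢p₂  = ∈-map⁺ φ (∈-─⁺ p₂∈Ps (∈Ps Pp) p≢p₂)
    ...   | yes refl = subst (_∈ₗ map φ Ps─p₂) φp₁≡φp₂ (∈-map⁺ φ (∈-─⁺ p₂∈Ps (∈Ps Pp₁) p₁≢p₂))

-- Rank, closure and hyperplanes

≤-maxℕ : ∀ {x xs} → x ∈ₗ xs → x ≤ maxℕ xs
≤-maxℕ {xs = y ∷ xs} (here refl)  = m≤m⊔n y (maxℕ xs)
≤-maxℕ {xs = y ∷ xs} (there x∈xs) = ≤-trans (≤-maxℕ x∈xs) (m≤n⊔m y (maxℕ xs))

maxℕ-attained : ∀ xs → maxℕ xs ≡ 0 ⊎ maxℕ xs ∈ₗ xs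
maxℕ-attained []       = inj₁ refl
maxℕ-attained (y ∷ xs) with ⊔-sel y (maxℕ xs)
... | inj₁ max≡y    = inj₂ (here max≡y)
... | inj₂ max≡rest with maxℕ-attained xs
...   | inj₁ rest≡0  = inj₁ (trans max≡rest rest≡0)
...   | inj₂ rest∈xs = inj₂ (there (subst (_∈ₗ xs) (sym max≡rest) rest∈xs))

module _ (M : Matroid n) where

  IsBasis : Subset n → Subset n → Set
  IsBasis X I = Indep M I × I ⊆ X × ∣ I ∣ ≡ rank M X

  ∣I∣≤rank : Indep M I → I ⊆ X → ∣ I ∣ ≤ rank M X
  ∣I∣≤rank {I} {X} indI I⊆X = ≤-maxℕ (∈-map⁺ ∣_∣
    (∈-filter⁺ (λ J → (J ⊆? X) ×-dec indep? M J) (∈-allSubsets I) (I⊆X , indI)))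

  ∃-basis : ∀ X → ∃ (IsBasis X)
  ∃-basis X with maxℕ-attained (map ∣_∣ (filter (λ J → (J ⊆? X) ×-dec indep? M J) (allSubsets n)))
  ... | inj₁ rank≡0 = ⊥ , indep-∅ M , ⊥⊆ , trans (∣⊥∣≡0 n) (sym rank≡0)
  ... | inj₂ rank∈  with ∈-map⁻ ∣_∣ rank∈
  ...   | I , I∈ , rank≡∣I∣
        with ∈-filter⁻ (λ J → (J ⊆? X) ×-dec indep? M J) {xs = allSubsets n} I∈
  ...     | _ , I⊆X , indI = I , indI , I⊆X , sym rank≡∣I∣

  rank≤∣∣ : ∀ X → rank M X ≤ ∣ X ∣
  rank≤∣∣ X with ∃-basis X
  ... | B , _ , B⊆X , ∣B∣≡r = subst (_≤ ∣ X ∣) ∣B∣≡r (p⊆q⇒∣p∣≤∣q∣ B⊆X)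

  rank-indep : Indep M I → rank M I ≡ ∣ I ∣
  rank-indep {I} indI = ≤-antisym (rank≤∣∣ I) (∣I∣≤rank indI ⊆-refl)

  rank-mono : X ⊆ Y → rank M X ≤ rank M Y
  rank-mono {X} X⊆Y with ∃-basis X
  ... | B , indB , B⊆X , ∣B∣≡r = subst (_≤ _) ∣B∣≡r (∣I∣≤rank indB (X⊆Y ∘ B⊆X))

  extend-to-basis : ∀ {I X} → Indep M I → I ⊆ X → ∃ λ J → I ⊆ J × IsBasis X J
  extend-to-basis {X = X} = go (⊃-wellFounded _)
    where
    go : Acc _⊃_ I → Indep M I → I ⊆ X → ∃ λ J → I ⊆ J × IsBasis X J
    go {I} (acc larger) indI I⊆X with rank M X ≤? ∣ I ∣
    ... | yes r≤∣I∣ = I , id , indI , I⊆X , ≤-antisym (∣I∣≤rank indI I⊆X) r≤∣I∣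
    ... | no  r≰∣I∣ with ∃-basis X
    ...   | B , indB , B⊆X , ∣B∣≡r
          with augment M indI indB (subst (∣ I ∣ <_) (sym ∣B∣≡r) (≰⇒> r≰∣I∣))
    ...     | e , e∈B , e∉I , indIe
            with go (larger (p⊆p∪q _ , e , y∈p∪⁅y⁆ , e∉I)) indIe (∪-least I⊆X (⁅x⁆⊆p (B⊆X e∈B)))
    ...       | J , I∪e⊆J , basis = J , I∪e⊆J ∘ p⊆p∪q _ , basis

  rank-maximal-indep : Indep M I → I ⊆ X → (∀ {x} → x ∈ X → x ∉ I → ¬ Indep M (I ∪ ⁅ x ⁆)) →
                       rank M X ≡ ∣ I ∣
  rank-maximal-indep {I} indI I⊆X maximal with extend-to-basis indI I⊆X
  ... | J , I⊆J , indJ , J⊆X , ∣J∣≡r =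
    ≤-antisym (subst (_≤ ∣ I ∣) ∣J∣≡r (p⊆q⇒∣p∣≤∣q∣ J⊆I)) (∣I∣≤rank indI I⊆X)
    where
    J⊆I : J ⊆ I
    J⊆I {x} x∈J = decidable-stable (x ∈? I) λ x∉I →
      maximal (J⊆X x∈J) x∉I (indep-⊆ M indJ (∪-least I⊆J (⁅x⁆⊆p x∈J)))

  rank-submodular : ∀ X Y → rank M (X ∪ Y) + rank M (X ∩ Y) ≤ rank M X + rank M Y
  rank-submodular X Y with ∃-basis (X ∩ Y)
  ... | I , indI , I⊆X∩Y , ∣I∣≡r with extend-to-basis indI (p⊆p∪q Y ∘ p∩q⊆p X Y ∘ I⊆X∩Y)
  ...   | J , I⊆J , indJ , J⊆X∪Y , ∣J∣≡r = begin
    rank M (X ∪ Y) + rank M (X ∩ Y) ≡⟨ cong₂ _+_ ∣J∣≡r ∣I∣≡r ⟨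
    ∣ J ∣ + ∣ I ∣                     ≤⟨ +-mono-≤ (p⊆q⇒∣p∣≤∣q∣ J⊆JX∪JY) (p⊆q⇒∣p∣≤∣q∣ I⊆JX∩JY) ⟩
    ∣ J ∩ X ∪ J ∩ Y ∣ + ∣ (J ∩ X) ∩ (J ∩ Y) ∣ ≡⟨ ∣p∣+∣q∣≡∣p∪q∣+∣p∩q∣ (J ∩ X) (J ∩ Y) ⟨
    ∣ J ∩ X ∣ + ∣ J ∩ Y ∣             ≤⟨ +-mono-≤ (∣J∩V∣≤rank X) (∣J∩V∣≤rank Y) ⟩
    rank M X + rank M Y             ∎
    where
    open ≤-Reasoning
    ∣J∩V∣≤rank : ∀ V → ∣ J ∩ V ∣ ≤ rank M V
    ∣J∩V∣≤rank V = ∣I∣≤rank (indep-⊆ M indJ (p∩q⊆p J V)) (p∩q⊆q J V)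
    J⊆JX∪JY : J ⊆ J ∩ X ∪ J ∩ Y
    J⊆JX∪JY x∈J = x∈p∪q⁺ (Sum.map (x∈p∩q⁺ ∘ (x∈J ,_)) (x∈p∩q⁺ ∘ (x∈J ,_)) (x∈p∪q⁻ X Y (J⊆X∪Y x∈J)))
    I⊆JX∩JY : I ⊆ (J ∩ X) ∩ (J ∩ Y)
    I⊆JX∩JY x∈I with x∈p∩q⁻ X Y (I⊆X∩Y x∈I)
    ... | x∈X , x∈Y = x∈p∩q⁺ (x∈p∩q⁺ (I⊆J x∈I , x∈X) , x∈p∩q⁺ (I⊆J x∈I , x∈Y))

  rank-∪⁅⁆≤ : ∀ X e → rank M (X ∪ ⁅ e ⁆) ≤ suc (rank M X)
  rank-∪⁅⁆≤ X e = begin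
    rank M (X ∪ ⁅ e ⁆)                     ≤⟨ m≤m+n _ _ ⟩
    rank M (X ∪ ⁅ e ⁆) + rank M (X ∩ ⁅ e ⁆) ≤⟨ rank-submodular X ⁅ e ⁆ ⟩
    rank M X + rank M ⁅ e ⁆                ≤⟨ +-monoʳ-≤ (rank M X) (rank≤∣∣ ⁅ e ⁆) ⟩
    rank M X + ∣ ⁅ e ⁆ ∣                    ≡⟨ cong (rank M X +_) (∣⁅x⁆∣≡1 e) ⟩
    rank M X + 1                           ≡⟨ +-comm (rank M X) 1 ⟩
    suc (rank M X)                         ∎
    where open ≤-Reasoning

  rank-indep-∪⁅⁆ : Indep M (I ∪ ⁅ e ⁆) → e ∉ I → rank M (I ∪ ⁅ e ⁆) ≡ suc (rank M I)
  rank-indep-∪⁅⁆ {I} {e} indIe e∉I = begin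
    rank M (I ∪ ⁅ e ⁆) ≡⟨ rank-indep indIe ⟩
    ∣ I ∪ ⁅ e ⁆ ∣       ≡⟨ ∣p∪⁅x⁆∣≡1+∣p∣ I e e∉I ⟩
    suc ∣ I ∣           ≡⟨ cong suc (rank-indep (indep-⊆ M indIe (p⊆p∪q _))) ⟨
    suc (rank M I)     ∎
    where open ≡-Reasoning

  indep-∪⁅⁆ : Indep M I → rank M (I ∪ ⁅ e ⁆) ≡ suc (rank M I) → Indep M (I ∪ ⁅ e ⁆)
  indep-∪⁅⁆ {I} {e} indI r≡ with ∃-basis (I ∪ ⁅ e ⁆)
  ... | B , indB , B⊆I∪e , ∣B∣≡r with augment M indI indB (subst (∣ I ∣ <_) ∣B∣≡1+∣I∣ (n<1+n ∣ I ∣))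
    where
    ∣B∣≡1+∣I∣ : suc ∣ I ∣ ≡ ∣ B ∣
    ∣B∣≡1+∣I∣ = sym (trans ∣B∣≡r (trans r≡ (cong suc (rank-indep indI))))
  ...   | x , x∈B , x∉I , indIx with x∈p∪⁅y⁆⁻ (B⊆I∪e x∈B)
  ...     | inj₁ x∈I  = contradiction x∈I x∉I
  ...     | inj₂ refl = indIx

  ∈-closure⁻ : x ∈ closure M X → x ∈ E M × rank M (X ∪ ⁅ x ⁆) ≡ rank M X
  ∈-closure⁻ {x} x∈clX with to T-∧ (to x∈tabulate⇔ x∈clX)
  ... | x∈E , r≡ = to (T-does⇔ (x ∈? E M)) x∈E , ≡ᵇ⇒≡ _ _ r≡

  ∈-closure⁺ : x ∈ E M → rank M (X ∪ ⁅ x ⁆) ≡ rank M X → x ∈ closure M X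
  ∈-closure⁺ {x} x∈E r≡ =
    from x∈tabulate⇔ (from T-∧ (from (T-does⇔ (x ∈? E M)) x∈E , ≡⇒≡ᵇ _ _ r≡))

  closure⊆E : closure M X ⊆ E M
  closure⊆E = proj₁ ∘ ∈-closure⁻

  ∉-closure⇒rank-suc : x ∈ E M → x ∉ closure M X → rank M (X ∪ ⁅ x ⁆) ≡ suc (rank M X)
  ∉-closure⇒rank-suc {x} {X} x∈E x∉clX with rank M (X ∪ ⁅ x ⁆) ≤? rank M X
  ... | yes r≤ = contradiction (∈-closure⁺ x∈E (≤-antisym r≤ (rank-mono (p⊆p∪q _)))) x∉clX
  ... | no  r≰ = ≤-antisym (rank-∪⁅⁆≤ X x) (≰⇒> r≰)

  rank-suc⇒∉-closure : rank M (X ∪ ⁅ x ⁆) ≡ suc (rank M X) → x ∉ closure M X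
  rank-suc⇒∉-closure r≡ x∈clX = 1+n≢n (trans (sym r≡) (proj₂ (∈-closure⁻ x∈clX)))

  ∉-closure⇒indep-∪⁅⁆ : Indep M I → x ∈ E M → x ∉ closure M I → Indep M (I ∪ ⁅ x ⁆)
  ∉-closure⇒indep-∪⁅⁆ indI x∈E x∉clI = indep-∪⁅⁆ indI (∉-closure⇒rank-suc x∈E x∉clI)

  indep-∪⁅⁆⇒∉-closure : Indep M (I ∪ ⁅ x ⁆) → x ∉ I → x ∉ closure M I
  indep-∪⁅⁆⇒∉-closure indIx x∉I = rank-suc⇒∉-closure (rank-indep-∪⁅⁆ indIx x∉I)

  ⊆-closure : X ⊆ E M → X ⊆ closure M X
  ⊆-closure X⊆E x∈X = ∈-closure⁺ (X⊆E x∈X) (cong (rank M) (p∪⁅x⁆≡p x∈X))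

  closure-mono : X ⊆ Y → closure M X ⊆ closure M Y
  closure-mono {X} {Y} X⊆Y {x} x∈clX with ∈-closure⁻ x∈clX
  ... | x∈E , rX∪x≡rX =
    ∈-closure⁺ x∈E (≤-antisym (+-cancelʳ-≤ (rank M X) _ _ submodular) (rank-mono (p⊆p∪q _)))
    where
    open ≤-Reasoning
    submodular : rank M (Y ∪ ⁅ x ⁆) + rank M X ≤ rank M Y + rank M X
    submodular = begin
      rank M (Y ∪ ⁅ x ⁆) + rank M X
        ≤⟨ +-mono-≤ (rank-mono (∪-least (q⊆p∪q _ Y) (p⊆p∪q Y ∘ q⊆p∪q X ⁅ x ⁆)))
                    (rank-mono (λ z∈X → x∈p∩q⁺ (p⊆p∪q ⁅ x ⁆ z∈X , X⊆Y z∈X))) ⟩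
      rank M ((X ∪ ⁅ x ⁆) ∪ Y) + rank M ((X ∪ ⁅ x ⁆) ∩ Y) ≤⟨ rank-submodular (X ∪ ⁅ x ⁆) Y ⟩
      rank M (X ∪ ⁅ x ⁆) + rank M Y ≡⟨ cong (_+ rank M Y) rX∪x≡rX ⟩
      rank M X + rank M Y           ≡⟨ +-comm (rank M X) (rank M Y) ⟩
      rank M Y + rank M X           ∎

  rank-∪-closure : Y ⊆ closure M X → rank M (X ∪ Y) ≡ rank M X
  rank-∪-closure {Y} {X} Y⊆clX with ∃-basis X
  ... | I , indI , I⊆X , ∣I∣≡r = trans (rank-maximal-indep indI (p⊆p∪q Y ∘ I⊆X) maximal) ∣I∣≡r
    where
    rank-∪⁅z⁆ : ∀ {z} → z ∈ X ∪ Y → rank M (X ∪ ⁅ z ⁆) ≡ rank M X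
    rank-∪⁅z⁆ z∈X∪Y = [ cong (rank M) ∘ p∪⁅x⁆≡p , proj₂ ∘ ∈-closure⁻ ∘ Y⊆clX ]′ (x∈p∪q⁻ X Y z∈X∪Y)
    maximal : ∀ {z} → z ∈ X ∪ Y → z ∉ I → ¬ Indep M (I ∪ ⁅ z ⁆)
    maximal {z} z∈X∪Y z∉I indIz = 1+n≰n (begin
      suc (rank M X)      ≡⟨ cong suc ∣I∣≡r ⟨
      suc ∣ I ∣            ≡⟨ ∣p∪⁅x⁆∣≡1+∣p∣ I z z∉I ⟨
      ∣ I ∪ ⁅ z ⁆ ∣        ≤⟨ ∣I∣≤rank indIz (∪-least (p⊆p∪q _ ∘ I⊆X) (q⊆p∪q X ⁅ z ⁆)) ⟩
      rank M (X ∪ ⁅ z ⁆)  ≡⟨ rank-∪⁅z⁆ z∈X∪Y ⟩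
      rank M X            ∎)
      where open ≤-Reasoning

  closure-least : Y ⊆ closure M X → closure M Y ⊆ closure M X
  closure-least {Y} {X} Y⊆clX {z} z∈clY with ∈-closure⁻ (closure-mono (q⊆p∪q X Y) z∈clY)
  ... | z∈E , r≡ = ∈-closure⁺ z∈E (≤-antisym (begin
    rank M (X ∪ ⁅ z ⁆)       ≤⟨ rank-mono (∪-least (p⊆p∪q _ ∘ p⊆p∪q Y) (q⊆p∪q (X ∪ Y) ⁅ z ⁆)) ⟩
    rank M ((X ∪ Y) ∪ ⁅ z ⁆) ≡⟨ r≡ ⟩
    rank M (X ∪ Y)           ≡⟨ rank-∪-closure Y⊆clX ⟩
    rank M X                 ∎) (rank-mono (p⊆p∪q _)))
    where open ≤-Reasoning

  closure-idem : closure M (closure M X) ≡ closure M X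
  closure-idem = ⊆-antisym (closure-least id) (⊆-closure closure⊆E)

  closure-cong : X ⊆ closure M Y → Y ⊆ closure M X → closure M X ≡ closure M Y
  closure-cong X⊆clY Y⊆clX = ⊆-antisym (closure-least X⊆clY) (closure-least Y⊆clX)

  rank-closure : X ⊆ E M → rank M (closure M X) ≡ rank M X
  rank-closure {X} X⊆E = ≤-antisym
    (≤-trans (rank-mono (q⊆p∪q X _)) (≤-reflexive (rank-∪-closure id)))
    (rank-mono (⊆-closure X⊆E))

  ⊆-closure-of-rank≥ : I ⊆ Z → Z ⊆ E M → rank M Z ≤ rank M I → Z ⊆ closure M I
  ⊆-closure-of-rank≥ I⊆Z Z⊆E rZ≤rI z∈Z = ∈-closure⁺ (Z⊆E z∈Z)
    (≤-antisym (≤-trans (rank-mono (∪-least I⊆Z (⁅x⁆⊆p z∈Z))) rZ≤rI) (rank-mono (p⊆p∪q _)))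

  closure-exchange : y ∈ E M → x ∉ closure M X → x ∈ closure M (X ∪ ⁅ y ⁆) →
                     y ∈ closure M (X ∪ ⁅ x ⁆)
  closure-exchange {y} {x} {X} y∈E x∉clX x∈clXy = ∈-closure⁺ y∈E (≤-antisym (begin
    rank M ((X ∪ ⁅ x ⁆) ∪ ⁅ y ⁆) ≡⟨ cong (rank M) (∪⁅⁆-swap X x y) ⟩
    rank M ((X ∪ ⁅ y ⁆) ∪ ⁅ x ⁆) ≡⟨ proj₂ (∈-closure⁻ x∈clXy) ⟩
    rank M (X ∪ ⁅ y ⁆)           ≤⟨ rank-∪⁅⁆≤ X y ⟩
    suc (rank M X)              ≡⟨ ∉-closure⇒rank-suc (closure⊆E x∈clXy) x∉clX ⟨
    rank M (X ∪ ⁅ x ⁆)           ∎) (rank-mono (p⊆p∪q _)))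
    where open ≤-Reasoning

  closure⊆flat : IsFlat M H → K ⊆ H → closure M K ⊆ H
  closure⊆flat {H} flat K⊆H = subst (_ ⊆_) flat (closure-mono K⊆H)

  flat⊆E : IsFlat M H → H ⊆ E M
  flat⊆E flat = closure⊆E ∘ subst (_ ∈_) (sym flat)

  hyperplane-closure : K ⊆ E M → suc (rank M K) ≡ rank M (E M) → IsHyperplane M (closure M K)
  hyperplane-closure K⊆E corank1 = closure-idem , trans (cong suc (rank-closure K⊆E)) corank1

  dependent⇒∈-closure : Indep M I → x ∈ E M → ¬ Indep M (I ∪ ⁅ x ⁆) → x ∈ closure M I
  dependent⇒∈-closure {I} {x} indI x∈E dep =
    decidable-stable (x ∈? closure M I) (dep ∘ ∉-closure⇒indep-∪⁅⁆ indI x∈E)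

  loop∈closure : e ∈ E M → ¬ Indep M ⁅ e ⁆ → e ∈ closure M X
  loop∈closure {e} e∈E dep = closure-mono ⊥⊆
    (dependent⇒∈-closure (indep-∅ M) e∈E (dep ∘ subst (Indep M) (∪-identityˡ ⁅ e ⁆)))

  nonloop∉closure⊥ : Indep M ⁅ e ⁆ → e ∉ closure M ⊥
  nonloop∉closure⊥ {e} indE =
    indep-∪⁅⁆⇒∉-closure (subst (Indep M) (sym (∪-identityˡ ⁅ e ⁆)) indE) ∉⊥

  fundamental-circuit : Indep M I → e ∈ E M → ¬ Indep M (I ∪ ⁅ e ⁆) →
                        ∃ λ C → IsCircuit M C × e ∈ C × C ⊆ I ∪ ⁅ e ⁆
  fundamental-circuit {I} {e} indI e∈E dep with ∃-minimal (λ J → ¬? (indep? M (J ∪ ⁅ e ⁆))) dep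
  ... | J , J⊆I , depJe , minimal =
    J ∪ ⁅ e ⁆ , (∪-least (indep⊆E M indI ∘ J⊆I) (⁅x⁆⊆p e∈E) , depJe , proper-indep) ,
    y∈p∪⁅y⁆ , ∪-least (p⊆p∪q _ ∘ J⊆I) (q⊆p∪q I ⁅ e ⁆)
    where
    proper-indep : ∀ D → D ⊆ J ∪ ⁅ e ⁆ → D ≢ J ∪ ⁅ e ⁆ → Indep M D
    proper-indep D D⊆Je D≢Je with ∃-∉ D⊆Je D≢Je
    ... | x , x∈Je , x∉D with x∈p∪⁅y⁆⁻ x∈Je
    ...   | inj₂ refl = indep-⊆ M indI (J⊆I ∘ ⊆p∪⁅y⁆⇒⊆p D⊆Je x∉D)
    ...   | inj₁ x∈J  =
      indep-⊆ M (decidable-stable (indep? M ((J - x) ∪ ⁅ e ⁆)) (minimal x∈J)) D⊆J-x∪e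
      where
      D⊆J-x∪e : D ⊆ (J - x) ∪ ⁅ e ⁆
      D⊆J-x∪e {y} y∈D with x∈p∪⁅y⁆⁻ (D⊆Je y∈D)
      ... | inj₁ y∈J  = p⊆p∪q _ (x∈p∧x≢y⇒x∈p-y y∈J λ { refl → x∉D y∈D })
      ... | inj₂ refl = y∈p∪⁅y⁆

  parallel⇒∈-closure : Parallel M x y → y ∈ closure M ⁅ x ⁆
  parallel⇒∈-closure {x} {y} (x≢y , C⊆E , dep , proper) = dependent⇒∈-closure indx (C⊆E y∈p∪⁅y⁆) dep
    where
    indx : Indep M ⁅ x ⁆
    indx = proper ⁅ x ⁆ (p⊆p∪q _) λ x≡xy →
      x≢y (sym (x∈⁅y⁆⇒x≡y x (subst (y ∈_) (sym x≡xy) y∈p∪⁅y⁆)))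

  ∈-closure⇒parallel : Indep M ⁅ x ⁆ → Indep M ⁅ y ⁆ → x ≢ y → y ∈ closure M ⁅ x ⁆ → Parallel M x y
  ∈-closure⇒parallel {x} {y} indx indy x≢y y∈clx =
    x≢y , ∪-least (indep⊆E M indx) (indep⊆E M indy) , dep , proper-indep
    where
    dep : ¬ Indep M (⁅ x ⁆ ∪ ⁅ y ⁆)
    dep indxy = indep-∪⁅⁆⇒∉-closure indxy (x≢y ∘ sym ∘ x∈⁅y⁆⇒x≡y x) y∈clx
    proper-indep : ∀ D → D ⊆ ⁅ x ⁆ ∪ ⁅ y ⁆ → D ≢ ⁅ x ⁆ ∪ ⁅ y ⁆ → Indep M D
    proper-indep D D⊆xy D≢xy with ∃-∉ D⊆xy D≢xy
    ... | z , z∈xy , z∉D with x∈p∪⁅y⁆⁻ z∈xy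
    ...   | inj₂ refl = indep-⊆ M indx (⊆p∪⁅y⁆⇒⊆p D⊆xy z∉D)
    ...   | inj₁ z∈x  = indep-⊆ M indy (⊆p∪⁅y⁆⇒⊆p (subst (D ⊆_) (∪-comm ⁅ x ⁆ ⁅ y ⁆) D⊆xy) x∉D)
      where
      x∉D : x ∉ D
      x∉D = subst (_∉ D) (x∈⁅y⁆⇒x≡y x z∈x) z∉D

  spanner-has-two-elements : Indep M X → Indep M ⁅ e ⁆ → e ∉ X →
                             (∀ {x} → x ∈ X → ¬ Parallel M x e) → Z ⊆ X → e ∈ closure M Z →
                             ∃₂ λ x₁ x₂ → x₁ ∈ Z × x₂ ∈ Z × x₁ ≢ x₂
  spanner-has-two-elements {X} {e} {Z} indX inde e∉X no-parallel Z⊆X e∈clZ with any? (_∈? Z)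
  ... | no ∄ = ⊥-elim (nonloop∉closure⊥ inde (closure-mono (λ x∈Z → ⊥-elim (∄ (_ , x∈Z))) e∈clZ))
  ... | yes (x₁ , x₁∈Z) with any? (λ x → x ∈? Z ×-dec ¬? (x ≟ x₁))
  ...   | yes (x₂ , x₂∈Z , x₂≢x₁) = x₁ , x₂ , x₁∈Z , x₂∈Z , x₂≢x₁ ∘ sym
  ...   | no ∄ = ⊥-elim (no-parallel x₁∈X (∈-closure⇒parallel (indep-⊆ M indX (⁅x⁆⊆p x₁∈X)) inde
                                             (λ { refl → e∉X x₁∈X }) (closure-mono Z⊆⁅x₁⁆ e∈clZ)))
    where
    x₁∈X : x₁ ∈ X
    x₁∈X = Z⊆X x₁∈Z
    Z⊆⁅x₁⁆ : Z ⊆ ⁅ x₁ ⁆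
    Z⊆⁅x₁⁆ {x} x∈Z = subst (_∈ ⁅ x₁ ⁆) (sym (decidable-stable (x ≟ x₁) λ x≢x₁ → ∄ (x , x∈Z , x≢x₁)))
                           (x∈⁅x⁆ x₁)

  -- Submodularity on (Y - x) ∪ e and Z ∪ e, whose intersection contains (Z - x) ∪ e.
  ∉-closure-minus : Indep M Y → Z ⊆ Y → x ∈ Z → e ∈ closure M Z → e ∉ closure M (Z - x) →
                    e ∉ closure M (Y - x)
  ∉-closure-minus {Y} {Z} {x} {e} indY Z⊆Y x∈Z e∈clZ e∉clZ-x e∈clY-x = 1+n≰n (begin
    suc (rank M W) + suc (rank M (Z - x))
      ≡⟨ cong (_+ suc (rank M (Z - x))) (rank-indep-∪⁅⁆ indW∪x (y∉p-y)) ⟨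
    rank M (W ∪ ⁅ x ⁆) + suc (rank M (Z - x))
      ≡⟨ cong₂ _+_ (cong (rank M) (p-y∪⁅y⁆≡p x∈Y)) (sym (∉-closure⇒rank-suc e∈E e∉clZ-x)) ⟩
    rank M Y + rank M ((Z - x) ∪ ⁅ e ⁆)
      ≤⟨ +-mono-≤ (rank-mono Y⊆∪) (rank-mono Z-x∪e⊆∩) ⟩
    rank M ((W ∪ ⁅ e ⁆) ∪ (Z ∪ ⁅ e ⁆)) + rank M ((W ∪ ⁅ e ⁆) ∩ (Z ∪ ⁅ e ⁆))
      ≤⟨ rank-submodular (W ∪ ⁅ e ⁆) (Z ∪ ⁅ e ⁆) ⟩
    rank M (W ∪ ⁅ e ⁆) + rank M (Z ∪ ⁅ e ⁆)
      ≡⟨ cong₂ _+_ (proj₂ (∈-closure⁻ e∈clY-x)) (proj₂ (∈-closure⁻ e∈clZ)) ⟩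
    rank M W + rank M Z
      ≤⟨ +-monoʳ-≤ (rank M W) (≤-trans (rank-mono (⊆-reflexive (sym (p-y∪⁅y⁆≡p x∈Z))))
                                        (rank-∪⁅⁆≤ (Z - x) x)) ⟩
    rank M W + suc (rank M (Z - x)) ∎)
    where
    open ≤-Reasoning
    W : Subset n
    W = Y - x
    x∈Y : x ∈ Y
    x∈Y = Z⊆Y x∈Z
    e∈E : e ∈ E M
    e∈E = proj₁ (∈-closure⁻ e∈clZ)
    indW∪x : Indep M (W ∪ ⁅ x ⁆)
    indW∪x = subst (Indep M) (sym (p-y∪⁅y⁆≡p x∈Y)) indY
    Y⊆∪ : Y ⊆ (W ∪ ⁅ e ⁆) ∪ (Z ∪ ⁅ e ⁆)
    Y⊆∪ {y} y∈Y with y ≟ x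
    ... | yes refl = q⊆p∪q _ _ (p⊆p∪q _ x∈Z)
    ... | no  y≢x  = p⊆p∪q _ (p⊆p∪q _ (x∈p∧x≢y⇒x∈p-y y∈Y y≢x))
    Z-x∪e⊆∩ : (Z - x) ∪ ⁅ e ⁆ ⊆ (W ∪ ⁅ e ⁆) ∩ (Z ∪ ⁅ e ⁆)
    Z-x∪e⊆∩ = ∪-least
      (λ z∈Z-x → let (z∈Z , z≢x) = x∈p-y⁻ z∈Z-x in
        x∈p∩q⁺ (p⊆p∪q _ (x∈p∧x≢y⇒x∈p-y (Z⊆Y z∈Z) z≢x) , p⊆p∪q _ z∈Z))
      (λ z∈e → x∈p∩q⁺ (q⊆p∪q _ _ z∈e , q⊆p∪q _ _ z∈e))

  Separates : Fin n → Fin n → Subset n → Set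
  Separates e e′ H = (e ∈ H × IsHyperplane M H) × e′ ∉ H

  separates? : ∀ e e′ → Decidable (Separates e e′)
  separates? e e′ H = ((e ∈? H) ×-dec isHyperplane? M H) ×-dec ¬? (e′ ∈? H)

  ¬separates-loop : e ∈ E M → ¬ Indep M ⁅ e ⁆ → ¬ Separates x e H
  ¬separates-loop e∈E dep ((_ , flat , _) , e∉H) = e∉H (closure⊆flat flat id (loop∈closure e∈E dep))

  h≡h⇔separating-counts-≡ : ∀ {e e′} →
                            h M e ≡ h M e′ ⇔ count (separates? e e′) ≡ count (separates? e′ e)
  h≡h⇔separating-counts-≡ {e} {e′} = mk⇔
    (λ h≡h → +-cancelˡ-≡ (#both e e′) _ _ (begin
      #both e e′ + #separating e e′  ≡⟨ split e e′ ⟨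
      h M e                         ≡⟨ h≡h ⟩
      h M e′                        ≡⟨ split e′ e ⟩
      #both e′ e + #separating e′ e  ≡⟨ cong (_+ #separating e′ e) both-sym ⟨
      #both e e′ + #separating e′ e  ∎))
    (λ #separating≡ → begin
      h M e                         ≡⟨ split e e′ ⟩
      #both e e′ + #separating e e′  ≡⟨ cong₂ _+_ both-sym #separating≡ ⟩
      #both e′ e + #separating e′ e  ≡⟨ split e′ e ⟨
      h M e′                        ∎)
    where
    open ≡-Reasoning
    through : ∀ e H → Dec (e ∈ H × IsHyperplane M H)
    through e H = (e ∈? H) ×-dec isHyperplane? M H
    #both #separating : Fin n → Fin n → ℕ
    #both e e′ = count (through e ∩? (e′ ∈?_))
    #separating e e′ = count (separates? e e′)
    split : ∀ e e′ → h M e ≡ #both e e′ + #separating e e′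
    split e e′ = count-split (through e) (e′ ∈?_)
    both-sym : #both e e′ ≡ #both e′ e
    both-sym = count-≐ (through e ∩? (e′ ∈?_)) (through e′ ∩? (e ∈?_)) (swap , swap)
      where
      swap : ∀ {a b H} → (a ∈ H × IsHyperplane M H) × b ∈ H → (b ∈ H × IsHyperplane M H) × a ∈ H
      swap ((a∈H , hyp) , b∈H) = (b∈H , hyp) , a∈H

-- Transpositions and clones

∈-image⇔ : ∀ (σ : Permutation′ n) → x ∈ image σ I ⇔ σ ⟨$⟩ˡ x ∈ I
∈-image⇔ {x = x} {I} σ = mk⇔
  (λ x∈σI → lookup⇒[]= (σ ⟨$⟩ˡ x) I (to T-≡ (to x∈tabulate⇔ x∈σI)))
  (λ σx∈I → from x∈tabulate⇔ (from T-≡ ([]=⇒lookup σx∈I)))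

image-transpose : ∀ {i j} → (i ∈ I ⇔ j ∈ J) → (j ∈ I ⇔ i ∈ J) →
                  (∀ {k} → k ≢ i → k ≢ j → k ∈ I ⇔ k ∈ J) → image (transpose i j) I ≡ J
image-transpose {I = I} {J} {i} {j} i⇔j j⇔i k⇔k =
  ⊆-antisym (to (swapped _) ∘ to (∈-image⇔ (transpose i j)))
            (from (∈-image⇔ (transpose i j)) ∘ from (swapped _))
  where
  swapped : ∀ k → PC.transpose j i k ∈ I ⇔ k ∈ J
  swapped k with k ≟ j
  ... | yes refl = i⇔j
  ... | no  k≢j with k ≟ i
  ...   | yes refl = j⇔i
  ...   | no  k≢i  = k⇔k k≢i k≢j

∈-transpose⇔ : ∀ {i j k} → i ∈ p → j ∈ p → k ∈ p ⇔ PC.transpose i j k ∈ p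
∈-transpose⇔ {i = i} {j} {k} i∈p j∈p with k ≟ i
... | yes refl = mk⇔ (λ _ → j∈p) (λ _ → i∈p)
... | no  k≢i with k ≟ j
...   | yes refl = mk⇔ (λ _ → i∈p) (λ _ → j∈p)
...   | no  k≢j  = ⇔-id _

∈p∪⁅x⁆⇒∈p∪⁅y⁆ : y ∉ p → y ∈ p ∪ ⁅ x ⁆ → x ∈ p ∪ ⁅ y ⁆
∈p∪⁅x⁆⇒∈p∪⁅y⁆ y∉p y∈p∪x with x∈p∪⁅y⁆⁻ y∈p∪x
... | inj₁ y∈p  = contradiction y∈p y∉p
... | inj₂ refl = y∈p∪⁅y⁆

∈p∪⁅x⁆⇔∈p∪⁅y⁆ : ∀ {k} → k ≢ x → k ≢ y → k ∈ p ∪ ⁅ x ⁆ ⇔ k ∈ p ∪ ⁅ y ⁆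
∈p∪⁅x⁆⇔∈p∪⁅y⁆ k≢x k≢y = mk⇔
  (p⊆p∪q _ ∘ [ id , ⊥-elim ∘ k≢x ]′ ∘ x∈p∪⁅y⁆⁻)
  (p⊆p∪q _ ∘ [ id , ⊥-elim ∘ k≢y ]′ ∘ x∈p∪⁅y⁆⁻)

module _ {x y : Fin n} where

  image-transpose-fixed : (x ∈ I ⇔ y ∈ I) → image (transpose x y) I ≡ I
  image-transpose-fixed x⇔y = image-transpose x⇔y (⇔-sym x⇔y) (λ _ _ → ⇔-id _)

  image-transpose-∪⁅ˡ⁆ : x ∉ X → y ∉ X → image (transpose x y) (X ∪ ⁅ x ⁆) ≡ X ∪ ⁅ y ⁆
  image-transpose-∪⁅ˡ⁆ x∉X y∉X = image-transpose
    (mk⇔ (λ _ → y∈p∪⁅y⁆) (λ _ → y∈p∪⁅y⁆))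
    (mk⇔ (∈p∪⁅x⁆⇒∈p∪⁅y⁆ y∉X) (∈p∪⁅x⁆⇒∈p∪⁅y⁆ x∉X))
    ∈p∪⁅x⁆⇔∈p∪⁅y⁆

  image-transpose-∪⁅ʳ⁆ : x ∉ X → y ∉ X → image (transpose x y) (X ∪ ⁅ y ⁆) ≡ X ∪ ⁅ x ⁆
  image-transpose-∪⁅ʳ⁆ x∉X y∉X = image-transpose
    (mk⇔ (∈p∪⁅x⁆⇒∈p∪⁅y⁆ x∉X) (∈p∪⁅x⁆⇒∈p∪⁅y⁆ y∉X))
    (mk⇔ (λ _ → y∈p∪⁅y⁆) (λ _ → y∈p∪⁅y⁆))
    (λ k≢x k≢y → ∈p∪⁅x⁆⇔∈p∪⁅y⁆ k≢y k≢x)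

Exchangeable : Matroid n → Fin n → Fin n → Set
Exchangeable L x y = ∀ {X} → X ⊆ E L → x ∉ X → y ∉ X → Indep L (X ∪ ⁅ x ⁆) ⇔ Indep L (X ∪ ⁅ y ⁆)

clones⇔exchangeable : ∀ (L : Matroid n) {x y} → x ∈ E L → y ∈ E L →
                      Clones L x y ⇔ Exchangeable L x y
clones⇔exchangeable {n} L {x} {y} x∈E y∈E = mk⇔ clones⇒exchangeable exchangeable⇒clones
  where
  clones⇒exchangeable : Clones L x y → Exchangeable L x y
  clones⇒exchangeable (_ , indep-invariant) {X} X⊆E x∉X y∉X =
    subst (λ J → Indep L (X ∪ ⁅ x ⁆) ⇔ Indep L J) (image-transpose-∪⁅ˡ⁆ x∉X y∉X)
      (indep-invariant (X ∪ ⁅ x ⁆) (∪-least X⊆E (⁅x⁆⊆p x∈E)))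

  exchangeable⇒clones : Exchangeable L x y → Clones L x y
  exchangeable⇒clones exchange = (λ _ → ∈-transpose⇔ x∈E y∈E) , indep-invariant
    where
    σ : Permutation′ n
    σ = transpose x y
    fixed : ∀ {I} → image σ I ≡ I → Indep L I ⇔ Indep L (image σ I)
    fixed {I} σI≡I = subst (λ J → Indep L I ⇔ Indep L J) (sym σI≡I) (⇔-id _)
    moved : ∀ {I X a b} → X ∪ ⁅ a ⁆ ≡ I → image σ (X ∪ ⁅ a ⁆) ≡ X ∪ ⁅ b ⁆ →
            Indep L (X ∪ ⁅ a ⁆) ⇔ Indep L (X ∪ ⁅ b ⁆) → Indep L I ⇔ Indep L (image σ I)
    moved {X = X} {a} refl σ[X∪a]≡X∪b = subst (λ J → Indep L (X ∪ ⁅ a ⁆) ⇔ Indep L J) (sym σ[X∪a]≡X∪b)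
    indep-invariant : ∀ I → I ⊆ E L → Indep L I ⇔ Indep L (image σ I)
    indep-invariant I I⊆E with x ∈? I | y ∈? I
    ... | yes x∈I | yes y∈I = fixed (image-transpose-fixed (mk⇔ (λ _ → y∈I) (λ _ → x∈I)))
    ... | no  x∉I | no  y∉I = fixed (image-transpose-fixed (mk⇔ (⊥-elim ∘ x∉I) (⊥-elim ∘ y∉I)))
    ... | yes x∈I | no  y∉I = moved (p-y∪⁅y⁆≡p x∈I) (image-transpose-∪⁅ˡ⁆ y∉p-y (y∉I ∘ p-y⊆p))
                                    (exchange (I⊆E ∘ p-y⊆p) y∉p-y (y∉I ∘ p-y⊆p))
    ... | no  x∉I | yes y∈I = moved (p-y∪⁅y⁆≡p y∈I) (image-transpose-∪⁅ʳ⁆ (x∉I ∘ p-y⊆p) y∉p-y)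
                                    (⇔-sym (exchange (I⊆E ∘ p-y⊆p) (x∉I ∘ p-y⊆p) y∉p-y))

-- An element freer than another

module FreerPair (M : Matroid n) {f g : Fin n} (f∈E : f ∈ E M) (g∈E : g ∈ E M) (f≢g : f ≢ g)
                 (f-freer : Freer M f g) where

  g∈closure : X ⊆ E M → f ∉ X → f ∈ closure M X → g ∈ closure M X
  g∈closure {X} X⊆E f∉X f∈clX with ∃-basis M X
  ... | I , indI , I⊆X , ∣I∣≡r with fundamental-circuit M indI f∈E depI∪f
    where
    depI∪f : ¬ Indep M (I ∪ ⁅ f ⁆)
    depI∪f indIf = 1+n≰n (begin
      suc (rank M X)      ≡⟨ cong suc ∣I∣≡r ⟨
      suc ∣ I ∣            ≡⟨ ∣p∪⁅x⁆∣≡1+∣p∣ I f (f∉X ∘ I⊆X) ⟨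
      ∣ I ∪ ⁅ f ⁆ ∣        ≤⟨ ∣I∣≤rank M indIf (∪-least (p⊆p∪q _ ∘ I⊆X) (q⊆p∪q X ⁅ f ⁆)) ⟩
      rank M (X ∪ ⁅ f ⁆)  ≡⟨ proj₂ (∈-closure⁻ M f∈clX) ⟩
      rank M X            ∎)
      where open ≤-Reasoning
  ... | C , circuit , f∈C , C⊆I∪f =
    closure-least M X∪f⊆clX (closure-mono M C⊆X∪f (f-freer C circuit f∈C))
    where
    X∪f⊆clX : X ∪ ⁅ f ⁆ ⊆ closure M X
    X∪f⊆clX = ∪-least (⊆-closure M X⊆E) (⁅x⁆⊆p f∈clX)
    C⊆X∪f : C ⊆ X ∪ ⁅ f ⁆
    C⊆X∪f = ∪-least (p⊆p∪q _ ∘ I⊆X) (q⊆p∪q X ⁅ f ⁆) ∘ C⊆I∪f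

  indep-∪g⇒indep-∪f : X ⊆ E M → f ∉ X → g ∉ X → Indep M (X ∪ ⁅ g ⁆) → Indep M (X ∪ ⁅ f ⁆)
  indep-∪g⇒indep-∪f X⊆E f∉X g∉X indXg =
    ∉-closure⇒indep-∪⁅⁆ M (indep-⊆ M indXg (p⊆p∪q _)) f∈E
      (indep-∪⁅⁆⇒∉-closure M indXg g∉X ∘ g∈closure X⊆E f∉X)

  closure[K∪f]-f⊆closure[K] : K ⊆ E M → f ∉ closure M K → g ∉ closure M (K ∪ ⁅ f ⁆) →
                              closure M (K ∪ ⁅ f ⁆) - f ⊆ closure M K
  closure[K∪f]-f⊆closure[K] {K} K⊆E f∉clK g∉clKf {x} x∈clKf-f with x∈p-y⁻ x∈clKf-f
  ... | x∈clKf , x≢f = decidable-stable (x ∈? closure M K) λ x∉clK →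
    g∉clKf (closure-least M K∪x⊆clKf (g∈closure K∪x⊆E (f∉K∪x x∉clK)
      (closure-exchange M f∈E x∉clK x∈clKf)))
    where
    K∪f⊆E : K ∪ ⁅ f ⁆ ⊆ E M
    K∪f⊆E = ∪-least K⊆E (⁅x⁆⊆p f∈E)
    K∪x⊆clKf : K ∪ ⁅ x ⁆ ⊆ closure M (K ∪ ⁅ f ⁆)
    K∪x⊆clKf = ∪-least (⊆-closure M K∪f⊆E ∘ p⊆p∪q _) (⁅x⁆⊆p x∈clKf)
    K∪x⊆E : K ∪ ⁅ x ⁆ ⊆ E M
    K∪x⊆E = closure⊆E M ∘ K∪x⊆clKf
    f∉K∪x : x ∉ closure M K → f ∉ K ∪ ⁅ x ⁆
    f∉K∪x x∉clK f∈K∪x with x∈p∪⁅y⁆⁻ f∈K∪x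
    ... | inj₁ f∈K  = f∉clK (⊆-closure M K⊆E f∈K)
    ... | inj₂ f≡x  = x≢f (sym f≡x)

  f↦g : Subset n → Subset n
  f↦g H = closure M ((H - f) ∪ ⁅ g ⁆)

  f↦g-closure : K ⊆ E M → f ∉ closure M K → g ∉ closure M (K ∪ ⁅ f ⁆) →
                suc (rank M (K ∪ ⁅ f ⁆)) ≡ rank M (E M) →
                Separates M f g (closure M (K ∪ ⁅ f ⁆)) ×
                f↦g (closure M (K ∪ ⁅ f ⁆)) ≡ closure M (K ∪ ⁅ g ⁆)
  f↦g-closure {K} K⊆E f∉clK g∉clKf corank1 =
    ((⊆-closure M K∪f⊆E y∈p∪⁅y⁆ , hyperplane-closure M K∪f⊆E corank1) , g∉clKf) ,
    closure-cong M
      (∪-least (closure-mono M (p⊆p∪q _) ∘ closure[K∪f]-f⊆closure[K] K⊆E f∉clK g∉clKf)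
               (⊆-closure M K∪g⊆E ∘ q⊆p∪q K ⁅ g ⁆))
      (⊆-closure M F-f∪g⊆E ∘ ∪-least (p⊆p∪q _ ∘ K⊆F-f) (q⊆p∪q _ ⁅ g ⁆))
    where
    F : Subset n
    F = closure M (K ∪ ⁅ f ⁆)
    K∪f⊆E : K ∪ ⁅ f ⁆ ⊆ E M
    K∪f⊆E = ∪-least K⊆E (⁅x⁆⊆p f∈E)
    K∪g⊆E : K ∪ ⁅ g ⁆ ⊆ E M
    K∪g⊆E = ∪-least K⊆E (⁅x⁆⊆p g∈E)
    F-f∪g⊆E : (F - f) ∪ ⁅ g ⁆ ⊆ E M
    F-f∪g⊆E = ∪-least (closure⊆E M ∘ p-y⊆p) (⁅x⁆⊆p g∈E)
    K⊆F-f : K ⊆ F - f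
    K⊆F-f x∈K = x∈p∧x≢y⇒x∈p-y (⊆-closure M K∪f⊆E (p⊆p∪q _ x∈K))
                               (λ { refl → f∉clK (⊆-closure M K⊆E x∈K) })

  f∉closure[H-f] : Separates M f g H → f ∉ closure M (H - f)
  f∉closure[H-f] ((_ , flat , _) , g∉H) =
    g∉H ∘ closure⊆flat M flat p-y⊆p ∘ g∈closure (flat⊆E M flat ∘ p-y⊆p) y∉p-y

  g∉closure[H-f] : Separates M f g H → g ∉ closure M (H - f)
  g∉closure[H-f] ((_ , flat , _) , g∉H) = g∉H ∘ closure⊆flat M flat p-y⊆p

  f↦g-separates : Separates M f g H → Separates M g f (f↦g H)
  f↦g-separates {H} sep@((f∈H , flat , corank1) , g∉H) =
    (⊆-closure M K∪g⊆E y∈p∪⁅y⁆ , hyperplane-closure M K∪g⊆E corank1′) , f∉clK∪g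
    where
    open ≡-Reasoning
    K∪g⊆E : (H - f) ∪ ⁅ g ⁆ ⊆ E M
    K∪g⊆E = ∪-least (flat⊆E M flat ∘ p-y⊆p) (⁅x⁆⊆p g∈E)
    corank1′ : suc (rank M ((H - f) ∪ ⁅ g ⁆)) ≡ rank M (E M)
    corank1′ = begin
      suc (rank M ((H - f) ∪ ⁅ g ⁆)) ≡⟨ cong suc (∉-closure⇒rank-suc M g∈E (g∉closure[H-f] sep)) ⟩
      suc (suc (rank M (H - f)))    ≡⟨ cong suc (∉-closure⇒rank-suc M f∈E (f∉closure[H-f] sep)) ⟨
      suc (rank M ((H - f) ∪ ⁅ f ⁆)) ≡⟨ cong (suc ∘ rank M) (p-y∪⁅y⁆≡p f∈H) ⟩
      suc (rank M H)                ≡⟨ corank1 ⟩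
      rank M (E M)                  ∎
    f∉clK∪g : f ∉ f↦g H
    f∉clK∪g = g∉H ∘ closure⊆flat M flat (⊆-reflexive (p-y∪⁅y⁆≡p f∈H))
                  ∘ closure-exchange M g∈E (f∉closure[H-f] sep)

  f↦g-onto : Indep M ⁅ g ⁆ → Separates M g f H → ∃ λ H′ → Separates M f g H′ × f↦g H′ ≡ H
  f↦g-onto {H} indg ((g∈H , flat , corank1) , f∉H) with extend-to-basis M indg (⁅x⁆⊆p g∈H)
  ... | I , ⁅g⁆⊆I , indI , I⊆H , ∣I∣≡r =
    closure M (K₀ ∪ ⁅ f ⁆) , proj₁ preimage , trans (proj₂ preimage) clK₀∪g≡H
    where
    open ≡-Reasoning
    K₀ : Subset n
    K₀ = I - g
    K₀∪g≡I : K₀ ∪ ⁅ g ⁆ ≡ I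
    K₀∪g≡I = p-y∪⁅y⁆≡p (⁅g⁆⊆I (x∈⁅x⁆ g))
    K₀⊆E : K₀ ⊆ E M
    K₀⊆E = flat⊆E M flat ∘ I⊆H ∘ p-y⊆p
    f∉clI : f ∉ closure M I
    f∉clI = f∉H ∘ closure⊆flat M flat I⊆H
    f∉clK₀ : f ∉ closure M K₀
    f∉clK₀ = f∉clI ∘ closure-mono M p-y⊆p
    g∉K₀∪f : g ∉ K₀ ∪ ⁅ f ⁆
    g∉K₀∪f g∈K₀∪f = [ y∉p-y , f≢g ∘ sym ]′ (x∈p∪⁅y⁆⁻ g∈K₀∪f)
    g∉clK₀∪f : g ∉ closure M (K₀ ∪ ⁅ f ⁆)
    g∉clK₀∪f = indep-∪⁅⁆⇒∉-closure M
      (indep-⊆ M (∉-closure⇒indep-∪⁅⁆ M indI f∈E f∉clI)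
        (∪-least (∪-least (p⊆p∪q _ ∘ p-y⊆p) (q⊆p∪q I ⁅ f ⁆)) (p⊆p∪q _ ∘ ⁅g⁆⊆I)))
      g∉K₀∪f
    rankI≡rankH : rank M I ≡ rank M H
    rankI≡rankH = trans (rank-indep M indI) ∣I∣≡r
    indK₀∪g : Indep M (K₀ ∪ ⁅ g ⁆)
    indK₀∪g = subst (Indep M) (sym K₀∪g≡I) indI
    corank1′ : suc (rank M (K₀ ∪ ⁅ f ⁆)) ≡ rank M (E M)
    corank1′ = begin
      suc (rank M (K₀ ∪ ⁅ f ⁆)) ≡⟨ cong suc (∉-closure⇒rank-suc M f∈E f∉clK₀) ⟩
      suc (suc (rank M K₀))    ≡⟨ cong suc (rank-indep-∪⁅⁆ M indK₀∪g y∉p-y) ⟨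
      suc (rank M (K₀ ∪ ⁅ g ⁆)) ≡⟨ cong (suc ∘ rank M) K₀∪g≡I ⟩
      suc (rank M I)          ≡⟨ cong suc rankI≡rankH ⟩
      suc (rank M H)          ≡⟨ corank1 ⟩
      rank M (E M)            ∎
    preimage : Separates M f g (closure M (K₀ ∪ ⁅ f ⁆)) ×
               f↦g (closure M (K₀ ∪ ⁅ f ⁆)) ≡ closure M (K₀ ∪ ⁅ g ⁆)
    preimage = f↦g-closure K₀⊆E f∉clK₀ g∉clK₀∪f corank1′
    H⊆clI : H ⊆ closure M I
    H⊆clI = ⊆-closure-of-rank≥ M I⊆H (flat⊆E M flat) (≤-reflexive (sym rankI≡rankH))
    clK₀∪g≡H : closure M (K₀ ∪ ⁅ g ⁆) ≡ H
    clK₀∪g≡H = begin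
      closure M (K₀ ∪ ⁅ g ⁆) ≡⟨ cong (closure M) K₀∪g≡I ⟩
      closure M I           ≡⟨ closure-cong M (⊆-closure M (flat⊆E M flat) ∘ I⊆H) H⊆clI ⟩
      closure M H           ≡⟨ flat ⟩
      H                     ∎

  Replaceable : Set
  Replaceable = ∀ {X} → X ⊆ E M → f ∉ X → g ∉ X → (∀ {x} → x ∈ X → ¬ Parallel M x g) →
                Indep M (X ∪ ⁅ f ⁆) → Indep M (X ∪ ⁅ g ⁆)

  replaceable⇒spanner : Replaceable → K ⊆ E M → g ∉ closure M K → y ∈ E M → y ∉ closure M K →
                        f ∉ closure M (K ∪ ⁅ y ⁆) → g ∈ closure M (K ∪ ⁅ y ⁆) → g ∈ closure M ⁅ y ⁆
  replaceable⇒spanner {K} {y} replace K⊆E g∉clK y∈E y∉clK f∉clK∪y g∈clK∪y with ∃-basis M K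
  ... | I , indI , I⊆K , ∣I∣≡r = decidable-stable (g ∈? closure M ⁅ y ⁆) λ g∉cly →
    indep-∪⁅⁆⇒∉-closure M (replace I∪y⊆E f∉I∪y (g∉I∪y g∉cly) (no-parallel g∉cly) indI∪y∪f)
      (g∉I∪y g∉cly) g∈clI∪y
    where
    I∪y⊆E : I ∪ ⁅ y ⁆ ⊆ E M
    I∪y⊆E = ∪-least (K⊆E ∘ I⊆K) (⁅x⁆⊆p y∈E)
    I∪y⊆K∪y : I ∪ ⁅ y ⁆ ⊆ K ∪ ⁅ y ⁆
    I∪y⊆K∪y = ∪-least (p⊆p∪q _ ∘ I⊆K) (q⊆p∪q K ⁅ y ⁆)
    K⊆clI : K ⊆ closure M I
    K⊆clI = ⊆-closure-of-rank≥ M I⊆K K⊆E (≤-reflexive (trans (sym ∣I∣≡r) (sym (rank-indep M indI))))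
    g∈clI∪y : g ∈ closure M (I ∪ ⁅ y ⁆)
    g∈clI∪y = closure-least M
      (∪-least (closure-mono M (p⊆p∪q _) ∘ K⊆clI) (⊆-closure M I∪y⊆E ∘ q⊆p∪q I ⁅ y ⁆)) g∈clK∪y
    indI∪y∪f : Indep M ((I ∪ ⁅ y ⁆) ∪ ⁅ f ⁆)
    indI∪y∪f = ∉-closure⇒indep-∪⁅⁆ M (∉-closure⇒indep-∪⁅⁆ M indI y∈E (y∉clK ∘ closure-mono M I⊆K))
                 f∈E (f∉clK∪y ∘ closure-mono M I∪y⊆K∪y)
    f∉I∪y : f ∉ I ∪ ⁅ y ⁆
    f∉I∪y = f∉clK∪y ∘ closure-mono M I∪y⊆K∪y ∘ ⊆-closure M I∪y⊆E
    g∉I∪y : g ∉ closure M ⁅ y ⁆ → g ∉ I ∪ ⁅ y ⁆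
    g∉I∪y g∉cly g∈I∪y with x∈p∪⁅y⁆⁻ g∈I∪y
    ... | inj₁ g∈I  = g∉clK (⊆-closure M K⊆E (I⊆K g∈I))
    ... | inj₂ refl = g∉cly (⊆-closure M (⁅x⁆⊆p g∈E) (x∈⁅x⁆ g))
    no-parallel : g ∉ closure M ⁅ y ⁆ → ∀ {x} → x ∈ I ∪ ⁅ y ⁆ → ¬ Parallel M x g
    no-parallel g∉cly x∈I∪y x∥g with x∈p∪⁅y⁆⁻ x∈I∪y
    ... | inj₁ x∈I  = g∉clK (closure-mono M (⁅x⁆⊆p (I⊆K x∈I)) (parallel⇒∈-closure M x∥g))
    ... | inj₂ refl = g∉cly (parallel⇒∈-closure M x∥g)

  -- g, the loops and the elements parallel to g: removing them from f↦g H leaves H - f.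
  Spanners : Subset n
  Spanners = tabulate λ x → does (g ∈? closure M ⁅ x ⁆)

  ∈-Spanners⇔ : x ∈ Spanners ⇔ g ∈ closure M ⁅ x ⁆
  ∈-Spanners⇔ {x} = ⇔-trans x∈tabulate⇔ (T-does⇔ (g ∈? closure M ⁅ x ⁆))

  g↦f : Subset n → Subset n
  g↦f H = (H ∩ ∁ Spanners) ∪ ⁅ f ⁆

  g↦f∘f↦g : Replaceable → Separates M f g H → g↦f (f↦g H) ≡ H
  g↦f∘f↦g {H} replace sep@((f∈H , flat , _) , g∉H) = ⊆-antisym ⊆H H⊆
    where
    K∪g⊆E : (H - f) ∪ ⁅ g ⁆ ⊆ E M
    K∪g⊆E = ∪-least (flat⊆E M flat ∘ p-y⊆p) (⁅x⁆⊆p g∈E)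
    H⊆ : H ⊆ g↦f (f↦g H)
    H⊆ {y} y∈H with y ≟ f
    ... | yes refl = y∈p∪⁅y⁆
    ... | no  y≢f  = p⊆p∪q _ (x∈p∩q⁺ (⊆-closure M K∪g⊆E (p⊆p∪q _ y∈K) , x∉p⇒x∈∁p y∉S))
      where
      y∈K : y ∈ H - f
      y∈K = x∈p∧x≢y⇒x∈p-y y∈H y≢f
      y∉S : y ∉ Spanners
      y∉S = g∉closure[H-f] sep ∘ closure-mono M (⁅x⁆⊆p y∈K) ∘ to ∈-Spanners⇔
    ⊆H : g↦f (f↦g H) ⊆ H
    ⊆H {y} y∈ with x∈p∪⁅y⁆⁻ y∈
    ... | inj₂ refl = f∈H
    ... | inj₁ y∈G∖S with x∈p∩q⁻ _ _ y∈G∖S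
    ...   | y∈G , y∈∁S = decidable-stable (y ∈? H) λ y∉H →
      x∈∁p⇒x∉p y∈∁S (from ∈-Spanners⇔ (replaceable⇒spanner replace (flat⊆E M flat ∘ p-y⊆p)
        (g∉closure[H-f] sep) (closure⊆E M y∈G) (y∉clK y∉H) f∉clK∪y
        (closure-exchange M g∈E (y∉clK y∉H) y∈G)))
      where
      y∉clK : y ∉ H → y ∉ closure M (H - f)
      y∉clK y∉H = y∉H ∘ closure⊆flat M flat p-y⊆p
      f∉clK∪y : f ∉ closure M ((H - f) ∪ ⁅ y ⁆)
      f∉clK∪y = proj₂ (f↦g-separates sep) ∘
        closure-least M (∪-least (⊆-closure M K∪g⊆E ∘ p⊆p∪q _) (⁅x⁆⊆p y∈G))

  extend-to-basis-through-f : f ∉ X → Indep M (X ∪ ⁅ f ⁆) →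
                              ∃ λ Y → X ⊆ Y × f ∉ Y × IsBasis M (E M) (Y ∪ ⁅ f ⁆)
  extend-to-basis-through-f {X} f∉X indXf with extend-to-basis M indXf (indep⊆E M indXf)
  ... | B , X∪f⊆B , basis =
    B - f , X⊆B-f , y∉p-y , subst (IsBasis M (E M)) (sym (p-y∪⁅y⁆≡p (X∪f⊆B y∈p∪⁅y⁆))) basis
    where
    X⊆B-f : X ⊆ B - f
    X⊆B-f x∈X = x∈p∧x≢y⇒x∈p-y (X∪f⊆B (p⊆p∪q _ x∈X)) λ { refl → f∉X x∈X }

  module _ {Y : Subset n} (f∉Y : f ∉ Y) (basis : IsBasis M (E M) (Y ∪ ⁅ f ⁆))
           (g∈clY : g ∈ closure M Y) where

    private
      indY∪f : Indep M (Y ∪ ⁅ f ⁆)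
      indY∪f = proj₁ basis
      Y⊆E : Y ⊆ E M
      Y⊆E = indep⊆E M indY∪f ∘ p⊆p∪q _
      f∉clY : f ∉ closure M Y
      f∉clY = indep-∪⁅⁆⇒∉-closure M indY∪f f∉Y
      rank[Y∪f]≡rank[E] : rank M (Y ∪ ⁅ f ⁆) ≡ rank M (E M)
      rank[Y∪f]≡rank[E] = trans (rank-indep M indY∪f) (proj₂ (proj₂ basis))

    closure-separates : Separates M g f (closure M Y)
    closure-separates = (g∈clY , hyperplane-closure M Y⊆E corank1) , f∉clY
      where
      corank1 : suc (rank M Y) ≡ rank M (E M)
      corank1 = trans (sym (rank-indep-∪⁅⁆ M indY∪f f∉Y)) rank[Y∪f]≡rank[E]

    f↦g-collapses : x ∈ Y → g ∉ closure M (Y - x) →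
                    Separates M f g (closure M ((Y - x) ∪ ⁅ f ⁆)) ×
                    f↦g (closure M ((Y - x) ∪ ⁅ f ⁆)) ≡ closure M Y ×
                    x ∉ closure M ((Y - x) ∪ ⁅ f ⁆)
    f↦g-collapses {x} x∈Y g∉clW = proj₁ preimage , trans (proj₂ preimage) clW∪g≡clY , x∉clW∪f
      where
      open ≡-Reasoning
      W : Subset n
      W = Y - x
      W⊆E : W ⊆ E M
      W⊆E = Y⊆E ∘ p-y⊆p
      W∪f∪x≡Y∪f : (W ∪ ⁅ f ⁆) ∪ ⁅ x ⁆ ≡ Y ∪ ⁅ f ⁆
      W∪f∪x≡Y∪f = trans (∪⁅⁆-swap W f x) (cong (_∪ ⁅ f ⁆) (p-y∪⁅y⁆≡p x∈Y))
      indW∪f∪x : Indep M ((W ∪ ⁅ f ⁆) ∪ ⁅ x ⁆)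
      indW∪f∪x = subst (Indep M) (sym W∪f∪x≡Y∪f) indY∪f
      x∉W∪f : x ∉ W ∪ ⁅ f ⁆
      x∉W∪f x∈W∪f = [ y∉p-y , (λ { refl → f∉Y x∈Y }) ]′ (x∈p∪⁅y⁆⁻ x∈W∪f)
      x∉clW∪f : x ∉ closure M (W ∪ ⁅ f ⁆)
      x∉clW∪f = indep-∪⁅⁆⇒∉-closure M indW∪f∪x x∉W∪f
      f∉clW : f ∉ closure M W
      f∉clW = f∉clY ∘ closure-mono M p-y⊆p
      W∪g⊆clY : W ∪ ⁅ g ⁆ ⊆ closure M Y
      W∪g⊆clY = ∪-least (⊆-closure M Y⊆E ∘ p-y⊆p) (⁅x⁆⊆p g∈clY)
      g∉clW∪f : g ∉ closure M (W ∪ ⁅ f ⁆)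
      g∉clW∪f = f∉clY ∘ closure-least M W∪g⊆clY ∘ closure-exchange M f∈E g∉clW
      corank1 : suc (rank M (W ∪ ⁅ f ⁆)) ≡ rank M (E M)
      corank1 = begin
        suc (rank M (W ∪ ⁅ f ⁆))          ≡⟨ rank-indep-∪⁅⁆ M indW∪f∪x x∉W∪f ⟨
        rank M ((W ∪ ⁅ f ⁆) ∪ ⁅ x ⁆)       ≡⟨ cong (rank M) W∪f∪x≡Y∪f ⟩
        rank M (Y ∪ ⁅ f ⁆)                ≡⟨ rank[Y∪f]≡rank[E] ⟩
        rank M (E M)                     ∎
      preimage : Separates M f g (closure M (W ∪ ⁅ f ⁆)) ×
                 f↦g (closure M (W ∪ ⁅ f ⁆)) ≡ closure M (W ∪ ⁅ g ⁆)
      preimage = f↦g-closure W⊆E f∉clW g∉clW∪f corank1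
      Y⊆clW∪g : Y ⊆ closure M (W ∪ ⁅ g ⁆)
      Y⊆clW∪g {y} y∈Y with y ≟ x
      ... | yes refl = closure-exchange M (Y⊆E x∈Y) g∉clW
                         (subst (λ V → g ∈ closure M V) (sym (p-y∪⁅y⁆≡p x∈Y)) g∈clY)
      ... | no  y≢x  = ⊆-closure M (closure⊆E M ∘ W∪g⊆clY) (p⊆p∪q _ (x∈p∧x≢y⇒x∈p-y y∈Y y≢x))
      clW∪g≡clY : closure M (W ∪ ⁅ g ⁆) ≡ closure M Y
      clW∪g≡clY = closure-cong M W∪g⊆clY Y⊆clW∪g

  module _ {X : Subset n} (f∉X : f ∉ X) (indX∪f : Indep M (X ∪ ⁅ f ⁆))
           (depX∪g : ¬ Indep M (X ∪ ⁅ g ⁆)) where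

    private
      indX : Indep M X
      indX = indep-⊆ M indX∪f (p⊆p∪q _)
      g∈clX : g ∈ closure M X
      g∈clX = dependent⇒∈-closure M indX g∈E depX∪g

    ∃-separates-g-f : ∃ (Separates M g f)
    ∃-separates-g-f with extend-to-basis-through-f f∉X indX∪f
    ... | Y , X⊆Y , f∉Y , basis =
      closure M Y , closure-separates f∉Y basis (closure-mono M X⊆Y g∈clX)

    f↦g-not-injective : Indep M ⁅ g ⁆ → g ∉ X → (∀ {x} → x ∈ X → ¬ Parallel M x g) →
                        ∃₂ λ H₁ H₂ → Separates M f g H₁ × Separates M f g H₂ ×
                                     H₁ ≢ H₂ × f↦g H₁ ≡ f↦g H₂
    f↦g-not-injective indg g∉X no-parallel
      with extend-to-basis-through-f f∉X indX∪f | ∃-minimal (λ Z → g ∈? closure M Z) g∈clX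
    ... | Y , X⊆Y , f∉Y , basis@(indY∪f , Y∪f⊆E , _) | Z , Z⊆X , g∈clZ , minimal
      with spanner-has-two-elements M indX indg g∉X no-parallel Z⊆X g∈clZ
    ... | x₁ , x₂ , x₁∈Z , x₂∈Z , x₁≢x₂ =
      Hyp x₁ , Hyp x₂ , proj₁ (collapse x₁∈Z) , proj₁ (collapse x₂∈Z) , H₁≢H₂ ,
      trans (proj₁ (proj₂ (collapse x₁∈Z))) (sym (proj₁ (proj₂ (collapse x₂∈Z))))
      where
      Hyp : Fin n → Subset n
      Hyp x = closure M ((Y - x) ∪ ⁅ f ⁆)
      Z⊆Y : Z ⊆ Y
      Z⊆Y = X⊆Y ∘ Z⊆X
      collapse : ∀ {x} → x ∈ Z → Separates M f g (Hyp x) × f↦g (Hyp x) ≡ closure M Y × x ∉ Hyp x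
      collapse x∈Z = f↦g-collapses f∉Y basis (closure-mono M Z⊆Y g∈clZ) (Z⊆Y x∈Z)
        (∉-closure-minus M (indep-⊆ M indY∪f (p⊆p∪q _)) Z⊆Y x∈Z g∈clZ (minimal x∈Z))
      x₂∈H₁ : x₂ ∈ Hyp x₁
      x₂∈H₁ = ⊆-closure M (Y∪f⊆E ∘ ∪-least (p⊆p∪q _ ∘ p-y⊆p) (q⊆p∪q Y ⁅ f ⁆))
                (p⊆p∪q _ (x∈p∧x≢y⇒x∈p-y (Z⊆Y x₂∈Z) (x₁≢x₂ ∘ sym)))
      H₁≢H₂ : Hyp x₁ ≢ Hyp x₂
      H₁≢H₂ H₁≡H₂ = proj₂ (proj₂ (collapse x₂∈Z)) (subst (x₂ ∈_) H₁≡H₂ x₂∈H₁)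

  counts-≡⇒replaceable : count (separates? M f g) ≡ count (separates? M g f) → Replaceable
  counts-≡⇒replaceable counts-≡ {X} _ f∉X g∉X no-parallel indX∪f =
    decidable-stable (indep? M (X ∪ ⁅ g ⁆)) λ depX∪g → case indep? M ⁅ g ⁆ of λ where
      (yes indg) →
        let (_ , _ , sep₁ , sep₂ , H₁≢H₂ , same-image) =
              f↦g-not-injective f∉X indX∪f depX∪g indg g∉X no-parallel
        in <-irrefl (sym counts-≡) (count-<-onto (separates? M f g) (separates? M g f) f↦g
                                      (f↦g-onto indg) sep₁ sep₂ H₁≢H₂ same-image)
      (no depg) →
        <-irrefl (trans (sym (count≡0 (separates? M f g) (λ _ → ¬separates-loop M g∈E depg)))
                        counts-≡)
                 (0<count (separates? M g f) (proj₂ (∃-separates-g-f f∉X indX∪f depX∪g)))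

  replaceable⇒counts-≡ : Replaceable → count (separates? M f g) ≡ count (separates? M g f)
  replaceable⇒counts-≡ replace with indep? M ⁅ g ⁆
  ... | yes indg = ≤-antisym
    (count-≤-onto (separates? M g f) (separates? M f g) g↦f
      (λ {H} sep → f↦g H , f↦g-separates sep , g↦f∘f↦g replace sep))
    (count-≤-onto (separates? M f g) (separates? M g f) f↦g (f↦g-onto indg))
  ... | no depg with indep? M ⁅ f ⁆
  ...   | no  depf = trans (count≡0 (separates? M f g) (λ _ → ¬separates-loop M g∈E depg))
                           (sym (count≡0 (separates? M g f) (λ _ → ¬separates-loop M f∈E depf)))
  ...   | yes indf = ⊥-elim (depg (subst (Indep M) (∪-identityˡ ⁅ g ⁆)
    (replace ⊥⊆ ∉⊥ ∉⊥ (⊥-elim ∘ ∉⊥) (subst (Indep M) (sym (∪-identityˡ ⁅ f ⁆)) indf))))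

  module _ (L : Matroid n) (deletion : IsDeletion L M (λ x → x ≢ f × x ≢ g × Parallel M x g)) where

    private
      E[L]⇔ : ∀ x → x ∈ E L ⇔ (x ∈ E M × ¬ (x ≢ f × x ≢ g × Parallel M x g))
      E[L]⇔ = proj₁ deletion
      indep[L]⇔ : ∀ I → Indep L I ⇔ (I ⊆ E L × Indep M I)
      indep[L]⇔ = proj₂ deletion

    f∈E[L] : f ∈ E L
    f∈E[L] = from (E[L]⇔ f) (f∈E , λ (f≢f , _) → f≢f refl)

    g∈E[L] : g ∈ E L
    g∈E[L] = from (E[L]⇔ g) (g∈E , λ (_ , g≢g , _) → g≢g refl)

    replaceable⇔exchangeable : Replaceable ⇔ Exchangeable L f g
    replaceable⇔exchangeable = mk⇔ replaceable⇒exchangeable exchangeable⇒replaceable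
      where
      indep[L]⁺ : X ⊆ E L → x ∈ E L → Indep M (X ∪ ⁅ x ⁆) → Indep L (X ∪ ⁅ x ⁆)
      indep[L]⁺ X⊆E[L] x∈E[L] indX∪x = from (indep[L]⇔ _) (∪-least X⊆E[L] (⁅x⁆⊆p x∈E[L]) , indX∪x)

      indep[L]⁻ : Indep L I → Indep M I
      indep[L]⁻ = proj₂ ∘ to (indep[L]⇔ _)

      replaceable⇒exchangeable : Replaceable → Exchangeable L f g
      replaceable⇒exchangeable replace {X} X⊆E[L] f∉X g∉X = mk⇔
        (indep[L]⁺ X⊆E[L] g∈E[L] ∘ replace X⊆E f∉X g∉X no-parallel ∘ indep[L]⁻)
        (indep[L]⁺ X⊆E[L] f∈E[L] ∘ indep-∪g⇒indep-∪f X⊆E f∉X g∉X ∘ indep[L]⁻)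
        where
        X⊆E : X ⊆ E M
        X⊆E = proj₁ ∘ to (E[L]⇔ _) ∘ X⊆E[L]
        no-parallel : ∀ {x} → x ∈ X → ¬ Parallel M x g
        no-parallel {x} x∈X x∥g =
          proj₂ (to (E[L]⇔ x) (X⊆E[L] x∈X)) ((λ { refl → f∉X x∈X }) , (λ { refl → g∉X x∈X }) , x∥g)

      exchangeable⇒replaceable : Exchangeable L f g → Replaceable
      exchangeable⇒replaceable exchange {X} X⊆E f∉X g∉X no-parallel =
        indep[L]⁻ ∘ to (exchange X⊆E[L] f∉X g∉X) ∘ indep[L]⁺ X⊆E[L] f∈E[L]
        where
        X⊆E[L] : X ⊆ E L
        X⊆E[L] {x} x∈X = from (E[L]⇔ x) (X⊆E x∈X , no-parallel x∈X ∘ proj₂ ∘ proj₂)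

proposition12 : {n : ℕ} (M : Matroid n) (f g : Fin n) →
    f ∈ E M → g ∈ E M → f ≢ g → Freer M f g →
    (L : Matroid n) →
    IsDeletion L M (λ x → x ≢ f × x ≢ g × Parallel M x g) →
    (h M f ≡ h M g ⇔ Clones L f g)
proposition12 M f g f∈E g∈E f≢g f-freer L deletion =
  ⇔-trans (h≡h⇔separating-counts-≡ M)
  (⇔-trans (mk⇔ counts-≡⇒replaceable replaceable⇒counts-≡)
  (⇔-trans (replaceable⇔exchangeable L deletion)
           (⇔-sym (clones⇔exchangeable L (f∈E[L] L deletion) (g∈E[L] L deletion)))))
  where open FreerPair M f∈E g∈E f≢g f-freer
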